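{- Let $\Gamma,\Delta$ be finite multisets of $\mathcal{L}^1$-formulas. For every propositional variable $p$ there exists a formula $\mathcal{A}_p(\Gamma;\Delta)$ such that: (i) $\mathsf{V}(\mathcal{A}_p(\Gamma;\Delta))\subseteq\mathsf{V}(\Gamma\cup\Delta)\setminus\{p\}$; (ii) $\mathsf{G}(\mathbf{KT_n})\vdash\Gamma,\mathcal{A}_p(\Gamma;\Delta)\Rightarrow\Delta$; (iii) for all finite multisets $\Pi,\Lambda$ of formulas with $p\notin\mathsf{V}(\Pi\cup\Lambda)$ and $\mathsf{G}(\mathbf{KT_n})\vdash\Pi,\Gamma\Rightarrow\Delta,\Lambda$, we have $\mathsf{G}(\mathbf{KT_n})\vdash\Pi\Rightarrow\mathcal{A}_p(\Gamma;\Delta),\Lambda$.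
   Context: Fix a finite set $\mathsf{Agt}$ of agents and a countable set $\mathsf{Prop}$ of propositional variables. Formulas of $\mathcal{L}^1$: $A::=p\mid\bot\mid A\wedge A\mid A\vee A\mid A\rightarrow A\mid\neg A\mid\Box_i A$. An outmost-boxed formula is one of the form $\Box_jB$; $\Box_i\Gamma=\{\Box_iA:A\in\Gamma\}$; $\mathsf{V}(\cdot)$ is the set of propositional variables occurring. A sequent $\Gamma\Rightarrow\Delta$ is a pair of finite multisets. $\mathsf{G}(\mathbf{KT_n})$: initial sequents $\Gamma,p\Rightarrow p,\Delta$ and $\bot,\Gamma\Rightarrow\Delta$; logical rules $(R\wedge)$: $\Gamma\Rightarrow\Delta,A_1$ and $\Gamma\Rightarrow\Delta,A_2$ / $\Gamma\Rightarrow\Delta,A_1\wedge A_2$; $(L\wedge)$: $A_1,A_2,\Gamma\Rightarrow\Delta$ / $A_1\wedge A_2,\Gamma\Rightarrow\Delta$; $(R\vee)$: $\Gamma\Rightarrow\Delta,A_1,A_2$ / $\Gamma\Rightarrow\Delta,A_1\vee A_2$; $(L\vee)$: $A_1,\Gamma\Rightarrow\Delta$ and $A_2,\Gamma\Rightarrow\Delta$ / $A_1\vee A_2,\Gamma\Rightarrow\Delta$; $(R\rightarrow)$: $A_1,\Gamma\Rightarrow\Delta,A_2$ / $\Gamma\Rightarrow\Delta,A_1\rightarrow A_2$; $(L\rightarrow)$: $\Gamma\Rightarrow\Delta,A_1$ and $A_2,\Gamma\Rightarrow\Delta$ / $A_1\rightarrow A_2,\Gamma\Rightarrow\Delta$;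 $(R\neg)$: $A,\Gamma\Rightarrow\Delta$ / $\Gamma\Rightarrow\Delta,\neg A$; $(L\neg)$: $\Gamma\Rightarrow\Delta,A$ / $\neg A,\Gamma\Rightarrow\Delta$. Modal rules: $(\Box_{Kn})$: from $\Gamma\Rightarrow A$ infer $\Sigma,\Box_i\Gamma\Rightarrow\Box_iA,\Omega$, where members of $\Sigma$ are propositional variables, $\bot$, or $\Box_jB$ with $j\neq i$, and members of $\Omega$ are propositional variables, $\bot$, or outmost-boxed formulas; $(\Box_{Tn})$: from $\Box_iA,A,\Gamma\Rightarrow\Delta$ infer $\Box_iA,\Gamma\Rightarrow\Delta$. $\vdash$ means derivable by a finite tree from initial sequents. -}

module Defs where

open import Data.Nat using (ℕ)
open import Data.Fin using (Fin)
open import Data.List using (List; []; _∷_; _++_; map)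
open import Data.List.Relation.Binary.Permutation.Propositional using (_↭_)
open import Data.List.Relation.Unary.All using (All)
open import Data.List.Relation.Unary.Any using (Any)
open import Data.Empty using (⊥)
open import Relation.Nullary using (¬_)
open import Relation.Binary.PropositionalEquality using (_≡_)

data Fm (n : ℕ) : Set where
  var  : ℕ → Fm n
  bot  : Fm n
  _∧_  : Fm n → Fm n → Fm n
  _∨_  : Fm n → Fm n → Fm n
  _⇒_  : Fm n → Fm n → Fm n
  ¬'_  : Fm n → Fm n
  □    : Fin n → Fm n → Fm n

-- Finite multisets are represented as lists; sequents are taken up to
-- permutation (see the exchange rule `perm` below).
Seq : ℕ → Set
Seq n = List (Fm n)

data Occ {n : ℕ} (p : ℕ) : Fm n → Set where
  occ-var : Occ p (var p)
  occ-∧l  : ∀ {A B} → Occ p A → Occ p (A ∧ B)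
  occ-∧r  : ∀ {A B} → Occ p B → Occ p (A ∧ B)
  occ-∨l  : ∀ {A B} → Occ p A → Occ p (A ∨ B)
  occ-∨r  : ∀ {A B} → Occ p B → Occ p (A ∨ B)
  occ-⇒l  : ∀ {A B} → Occ p A → Occ p (A ⇒ B)
  occ-⇒r  : ∀ {A B} → Occ p B → Occ p (A ⇒ B)
  occ-¬   : ∀ {A} → Occ p A → Occ p (¬' A)
  occ-□   : ∀ {i A} → Occ p A → Occ p (□ i A)

OccL : ∀ {n} → ℕ → List (Fm n) → Set
OccL p Γ = Any (Occ p) Γ

data SideL {n : ℕ} (i : Fin n) : Fm n → Set where
  sl-var : ∀ q → SideL i (var q)
  sl-bot : SideL i bot
  sl-box : ∀ j B → ¬ (j ≡ i) → SideL i (□ j B)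

data SideR {n : ℕ} : Fm n → Set where
  sr-var : ∀ q → SideR (var q)
  sr-bot : SideR bot
  sr-box : ∀ j B → SideR (□ j B)

infix 4 _⊢_

-- Derivability in G(KT_n); principal formulas are listed first,
-- and `perm` makes the antecedent/succedent behave as multisets.
data _⊢_ {n : ℕ} : List (Fm n) → List (Fm n) → Set where
  perm  : ∀ {Γ Γ' Δ Δ'} → Γ ↭ Γ' → Δ ↭ Δ' → Γ ⊢ Δ → Γ' ⊢ Δ'
  init  : ∀ {Γ Δ} p → (var p ∷ Γ) ⊢ (var p ∷ Δ)
  botL  : ∀ {Γ Δ} → (bot ∷ Γ) ⊢ Δ
  R∧    : ∀ {Γ Δ A B} → Γ ⊢ (A ∷ Δ) → Γ ⊢ (B ∷ Δ) → Γ ⊢ (A ∧ B ∷ Δ)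
  L∧    : ∀ {Γ Δ A B} → (A ∷ B ∷ Γ) ⊢ Δ → (A ∧ B ∷ Γ) ⊢ Δ
  R∨    : ∀ {Γ Δ A B} → Γ ⊢ (A ∷ B ∷ Δ) → Γ ⊢ (A ∨ B ∷ Δ)
  L∨    : ∀ {Γ Δ A B} → (A ∷ Γ) ⊢ Δ → (B ∷ Γ) ⊢ Δ → (A ∨ B ∷ Γ) ⊢ Δ
  R⇒    : ∀ {Γ Δ A B} → (A ∷ Γ) ⊢ (B ∷ Δ) → Γ ⊢ (A ⇒ B ∷ Δ)
  L⇒    : ∀ {Γ Δ A B} → Γ ⊢ (A ∷ Δ) → (B ∷ Γ) ⊢ Δ → (A ⇒ B ∷ Γ) ⊢ Δ
  R¬    : ∀ {Γ Δ A} → (A ∷ Γ) ⊢ Δ → Γ ⊢ (¬' A ∷ Δ)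
  L¬    : ∀ {Γ Δ A} → Γ ⊢ (A ∷ Δ) → (¬' A ∷ Γ) ⊢ Δ
  □Kn   : ∀ {Γ A Σ Ω} i → All (SideL i) Σ → All SideR Ω →
          Γ ⊢ (A ∷ []) → (Σ ++ map (□ i) Γ) ⊢ (□ i A ∷ Ω)
  □Tn   : ∀ {Γ Δ A} i → (□ i A ∷ A ∷ Γ) ⊢ Δ → (□ i A ∷ Γ) ⊢ Δ

{-# OPTIONS --safe #-}

-- A Pitts-style construction: the interpolant of Γ ⇒ Δ is computed by root-first proof search
-- with the invertible rules: a compound formula is replaced by the premises of its
-- rule (the interpolant becomes a conjunction over them), and a box □ᵢ B in the antecedent is
-- kept while its body B is added, as in (□Tn).  This ends in critical sequents Θ ⇒ Ω made of
-- variables, ⊥ and boxes, whose interpolant is a disjunction of literals for the variables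
-- (⊤ for an axiom), of □ᵢ A_p(Θᵢ ; B) for each □ᵢ B in Ω, and of ¬□ᵢ¬A_p(Θᵢ ; ∅) for each agent i,
-- where Θᵢ collects the bodies of the i-boxes of Θ and the inner interpolants have smaller modal
-- depth.  For (iii) a derivation of Π, Γ ⇒ Δ, Λ is taken
-- through the same decomposition by height-preserving inversion; at a critical sequent one
-- inducts on its height: rules acting on Π ⇒ Λ commute with the interpolant, (□Kn) yields one of
-- the modal disjuncts, and (□Tn) on a box of Θ is redundant, since its body was already
-- decomposed into the sequent and can be absorbed by height-preserving inversion and contraction.

module Submission where

open import Defs
import Algebra.Solver.CommutativeMonoid as CommutativeMonoidSolver
open import Data.Empty using (⊥; ⊥-elim)
open import Data.Fin using (Fin)
open import Data.Fin.Properties using () renaming (_≟_ to _≟ᶠ_)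
open import Data.List using (List; []; _∷_; _++_; [_]; map; concat; concatMap; allFin)
open import Data.List.Extrema.Nat using (max; xs≤max)
open import Data.List.Membership.Propositional using (_∈_; find; lose)
open import Data.List.Membership.Propositional.Properties
  using (∈-∃++; ∈-++⁺ˡ; ∈-++⁺ʳ; ∈-++⁻; ∈-map⁺; ∈-map⁻; ∈-allFin)
open import Data.List.Properties using (map-++; concat-++; ++-assoc; ++-identityʳ)
open import Data.List.Relation.Binary.Permutation.Propositional
  using (_↭_; ↭-refl; ↭-sym; ↭-trans; ↭-reflexive; prep; swap)
import Data.List.Relation.Binary.Permutation.Propositional as ↭
open import Data.List.Relation.Binary.Permutation.Propositional.Properties
  using (∈-resp-↭; All-resp-↭; ++⁺ˡ; ++⁺ʳ; shift; shifts; drop-∷; ++-commutativeMonoid)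
open import Data.List.Relation.Binary.Subset.Propositional using (_⊆_)
open import Data.List.Relation.Binary.Subset.Propositional.Properties using (xs⊆xs++ys)
open import Data.List.Relation.Unary.All using (All; []; _∷_)
import Data.List.Relation.Unary.All as All
import Data.List.Relation.Unary.All.Properties as All
open import Data.List.Relation.Unary.Any using (Any; here; there)
import Data.List.Relation.Unary.Any as Any
open import Data.Nat using (ℕ; zero; suc; _≤_; _<_; _+_; _⊔_; z≤n; s≤s)
open import Data.Nat.ListAction using (sum)
open import Data.Nat.ListAction.Properties using (sum-++)
open import Data.Nat.Properties
  using ( module ≤-Reasoning; ≤-refl; ≤-trans; ≤-pred; <-≤-trans; n≤1+n; m≤m+n; m≤n+m; m<n+m
        ; m≤m⊔n; m≤n⊔m; +-identityʳ; +-assoc; +-monoˡ-<; +-commutativeSemigroup)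
  renaming (_≟_ to _≟ℕ_)
open import Algebra.Properties.CommutativeSemigroup +-commutativeSemigroup using (interchange)
open import Data.Product using (Σ; _×_; _,_; proj₂; ∃-syntax)
open import Data.Sum using (_⊎_; inj₁; inj₂)
open import Function using (_∘_)
open import Relation.Binary.Construct.Closure.ReflexiveTransitive using (Star; ε; _◅_; _◅◅_)
open import Relation.Binary.PropositionalEquality
  using (_≡_; refl; sym; trans; cong; cong₂; subst; subst₂)
open import Relation.Nullary using (¬_; yes; no; Dec)
open import Relation.Nullary.Decidable using (map′)

module ↭-Solver {a} (A : Set a) = CommutativeMonoidSolver (++-commutativeMonoid {A = A})

module _ {a} {A : Set a} where
  private variable
    x y : A
    X X₀ X₁ : List A

  ∈⇒↭∷ : x ∈ X → ∃[ X′ ] X ↭ x ∷ X′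
  ∈⇒↭∷ x∈X with us , vs , refl ← ∈-∃++ x∈X = us ++ vs , shift _ us vs

  ↭-∷-inv : X ↭ x ∷ X₀ → X ↭ y ∷ X₁ →
            (x ≡ y × X₀ ↭ X₁) ⊎ ∃[ X₂ ] (X₀ ↭ y ∷ X₂ × X₁ ↭ x ∷ X₂)
  ↭-∷-inv {x = x} {y = y} π ρ with ∈-resp-↭ (↭-trans (↭-sym ρ) π) (here refl)
  ... | here refl = inj₁ (refl , drop-∷ (↭-trans (↭-sym π) ρ))
  ... | there y∈X₀ with X₂ , X₀↭ ← ∈⇒↭∷ y∈X₀ =
    inj₂ (X₂ , X₀↭ , drop-∷ (↭-trans (↭-sym ρ) (↭-trans π (↭-trans (prep x X₀↭) (swap x y ↭-refl)))))

  ↭-∷∷-inv : X ↭ x ∷ X₀ → X ↭ y ∷ y ∷ X₁ →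
             (x ≡ y × X₀ ↭ y ∷ X₁) ⊎ ∃[ X₂ ] (X₀ ↭ y ∷ y ∷ X₂ × X₁ ↭ x ∷ X₂)
  ↭-∷∷-inv π ρ with ↭-∷-inv π ρ
  ... | inj₁ same = inj₁ same
  ... | inj₂ (X₂ , X₀↭ , yX₁↭) with ↭-∷-inv yX₁↭ ↭-refl
  ...   | inj₁ (refl , X₂↭) = inj₁ (refl , ↭-trans X₀↭ (prep _ X₂↭))
  ...   | inj₂ (X₃ , X₂↭ , X₁↭) = inj₂ (X₃ , ↭-trans X₀↭ (prep _ X₂↭) , X₁↭)

  ∈-++-[] : x ∈ X ++ [] → x ∈ X
  ∈-++-[] {X = X} = subst (_ ∈_) (++-identityʳ X)

module _ {n : ℕ} where
  private
    variable
      q : ℕ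
      i : Fin n
      A B C E F G : Fm n
      X X′ X₀ Y Y′ Y₀ Z S Ls Rs Ls′ Rs′ M N M′ N′ Es : Seq n
      d s h h′ : ℕ
    open ↭-Solver (Fm n) using (solve; _⊕_; _⊜_)

  size : Fm n → ℕ
  size (var _) = 1
  size bot     = 1
  size (A ∧ B) = suc (size A + size B)
  size (A ∨ B) = suc (size A + size B)
  size (A ⇒ B) = suc (size A + size B)
  size (¬' A)  = suc (size A)
  size (□ _ A) = suc (size A)

  0<size : ∀ F → 0 < size F
  0<size (var _) = s≤s z≤n
  0<size bot     = s≤s z≤n
  0<size (_ ∧ _) = s≤s z≤n
  0<size (_ ∨ _) = s≤s z≤n
  0<size (_ ⇒ _) = s≤s z≤n
  0<size (¬' _)  = s≤s z≤n
  0<size (□ _ _) = s≤s z≤n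

  weight : Seq n → ℕ
  weight X = sum (map size X)

  weight-++ : ∀ X Y → weight (X ++ Y) ≡ weight X + weight Y
  weight-++ X Y = trans (cong sum (map-++ size X Y)) (sum-++ (map size X) (map size Y))

  depth : Fm n → ℕ
  depth (var _) = 0
  depth bot     = 0
  depth (A ∧ B) = depth A ⊔ depth B
  depth (A ∨ B) = depth A ⊔ depth B
  depth (A ⇒ B) = depth A ⊔ depth B
  depth (¬' A)  = depth A
  depth (□ _ A) = suc (depth A)

  infix 4 _≺_ _≼_ _⊑_

  data _≺_ : Fm n → Fm n → Set where
    ∧ˡ : A ≺ A ∧ B
    ∧ʳ : B ≺ A ∧ B
    ∨ˡ : A ≺ A ∨ B
    ∨ʳ : B ≺ A ∨ B
    ⇒ˡ : A ≺ A ⇒ B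
    ⇒ʳ : B ≺ A ⇒ B
    ¬-body : A ≺ ¬' A
    □-body : A ≺ □ i A

  _≼_ : Fm n → Fm n → Set
  _≼_ = Star _≺_

  ≺-occ : G ≺ F → Occ q G → Occ q F
  ≺-occ ∧ˡ = occ-∧l
  ≺-occ ∧ʳ = occ-∧r
  ≺-occ ∨ˡ = occ-∨l
  ≺-occ ∨ʳ = occ-∨r
  ≺-occ ⇒ˡ = occ-⇒l
  ≺-occ ⇒ʳ = occ-⇒r
  ≺-occ ¬-body = occ-¬
  ≺-occ □-body = occ-□

  ≺-depth : G ≺ F → depth G ≤ depth F
  ≺-depth (∧ˡ {A} {B}) = m≤m⊔n (depth A) (depth B)
  ≺-depth (∧ʳ {B} {A}) = m≤n⊔m (depth A) (depth B)
  ≺-depth (∨ˡ {A} {B}) = m≤m⊔n (depth A) (depth B)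
  ≺-depth (∨ʳ {B} {A}) = m≤n⊔m (depth A) (depth B)
  ≺-depth (⇒ˡ {A} {B}) = m≤m⊔n (depth A) (depth B)
  ≺-depth (⇒ʳ {B} {A}) = m≤n⊔m (depth A) (depth B)
  ≺-depth ¬-body       = ≤-refl
  ≺-depth □-body       = n≤1+n _

  ≼-occ : G ≼ F → Occ q G → Occ q F
  ≼-occ ε        o = o
  ≼-occ (s ◅ ss) o = ≼-occ ss (≺-occ s o)

  ≼-depth : G ≼ F → depth G ≤ depth F
  ≼-depth ε        = ≤-refl
  ≼-depth (s ◅ ss) = ≤-trans (≺-depth s) (≼-depth ss)

  _⊑_ : Seq n → Seq n → Set
  X ⊑ Y = ∀ {G} → G ∈ X → Any (G ≼_) Y

  ⊆⇒⊑ : X ⊆ Y → X ⊑ Y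
  ⊆⇒⊑ X⊆Y G∈X = Any.map (λ { refl → ε }) (X⊆Y G∈X)

  ↭⇒⊑ : X ↭ Y → X ⊑ Y
  ↭⇒⊑ π = ⊆⇒⊑ (∈-resp-↭ π)

  ≺⇒⊑ : All (_≺ F) X → F ∈ Y → X ⊑ Y
  ≺⇒⊑ X≺F F∈Y G∈X = Any.map (λ { refl → All.lookup X≺F G∈X ◅ ε }) F∈Y

  ⊑-trans : X ⊑ Y → Y ⊑ Z → X ⊑ Z
  ⊑-trans X⊑Y Y⊑Z G∈X with F , F∈Y , G≼F ← find (X⊑Y G∈X) =
    Any.map (G≼F ◅◅_) (Y⊑Z F∈Y)

  ⊑-++ : X ⊑ Z → Y ⊑ Z → X ++ Y ⊑ Z
  ⊑-++ {X = X} X⊑Z Y⊑Z G∈ with ∈-++⁻ X G∈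
  ... | inj₁ G∈X = X⊑Z G∈X
  ... | inj₂ G∈Y = Y⊑Z G∈Y

  ⊑-replace : All (_≺ F) Z → X ↭ Z ++ S → Y ↭ F ∷ S → X ⊑ Y
  ⊑-replace Z≺F πX πY =
    ⊑-trans (↭⇒⊑ πX)
      (⊑-++ (≺⇒⊑ Z≺F (∈-resp-↭ (↭-sym πY) (here refl))) (⊆⇒⊑ (∈-resp-↭ (↭-sym πY) ∘ there)))

  ⊑-occ : X ⊑ Y → OccL q X → OccL q Y
  ⊑-occ X⊑Y o with G , G∈X , oG ← find o =
    Any.map (λ G≼F → ≼-occ G≼F oG) (X⊑Y G∈X)

  ¬OccL-⊑ : X ⊑ Y → ¬ OccL q Y → ¬ OccL q X
  ¬OccL-⊑ X⊑Y ¬occ o = ¬occ (⊑-occ X⊑Y o)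

  var-fresh : ∀ {r} → ¬ OccL q X → var r ∈ X → ¬ r ≡ q
  var-fresh ¬occ x refl = ¬occ (lose x occ-var)

  ⊑-depth : X ⊑ Y → All (λ F → depth F ≤ d) Y → All (λ F → depth F ≤ d) X
  ⊑-depth X⊑Y bounded = All.tabulate λ G∈X →
    let F , F∈Y , G≼F = find (X⊑Y G∈X) in ≤-trans (≼-depth G≼F) (All.lookup bounded F∈Y)

  -- Rules as lists of premises

  data Compound : Fm n → Set where
    c∧ : Compound (A ∧ B)
    c∨ : Compound (A ∨ B)
    c⇒ : Compound (A ⇒ B)
    c¬ : Compound (¬' A)

  atomic-or-compound : (F : Fm n) → SideR F ⊎ Compound F
  atomic-or-compound (var q) = inj₁ (sr-var q)
  atomic-or-compound bot     = inj₁ sr-bot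
  atomic-or-compound (_ ∧ _) = inj₂ c∧
  atomic-or-compound (_ ∨ _) = inj₂ c∨
  atomic-or-compound (_ ⇒ _) = inj₂ c⇒
  atomic-or-compound (¬' _)  = inj₂ c¬
  atomic-or-compound (□ i B) = inj₁ (sr-box i B)

  -- A premise (Ls , Rs) replaces the principal formula by Ls in the antecedent and by Rs in the
  -- succedent.  Non-compound formulas get no premises; every use is guarded by Compound.
  leftPremises : Fm n → List (Seq n × Seq n)
  leftPremises (A ∧ B) = (A ∷ B ∷ [] , []) ∷ []
  leftPremises (A ∨ B) = (A ∷ [] , []) ∷ (B ∷ [] , []) ∷ []
  leftPremises (A ⇒ B) = ([] , A ∷ []) ∷ (B ∷ [] , []) ∷ []
  leftPremises (¬' A)  = ([] , A ∷ []) ∷ []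
  leftPremises _       = []

  rightPremises : Fm n → List (Seq n × Seq n)
  rightPremises (A ∧ B) = ([] , A ∷ []) ∷ ([] , B ∷ []) ∷ []
  rightPremises (A ∨ B) = ([] , A ∷ B ∷ []) ∷ []
  rightPremises (A ⇒ B) = (A ∷ [] , B ∷ []) ∷ []
  rightPremises (¬' A)  = (A ∷ [] , []) ∷ []
  rightPremises _       = []

  leftPremise-≺ : (Ls , Rs) ∈ leftPremises F → All (_≺ F) (Ls ++ Rs)
  leftPremise-≺ {F = _ ∧ _} (here refl)         = ∧ˡ ∷ ∧ʳ ∷ []
  leftPremise-≺ {F = _ ∨ _} (here refl)         = ∨ˡ ∷ []
  leftPremise-≺ {F = _ ∨ _} (there (here refl)) = ∨ʳ ∷ []
  leftPremise-≺ {F = _ ⇒ _} (here refl)         = ⇒ˡ ∷ []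
  leftPremise-≺ {F = _ ⇒ _} (there (here refl)) = ⇒ʳ ∷ []
  leftPremise-≺ {F = ¬' _}  (here refl)         = ¬-body ∷ []

  rightPremise-≺ : (Ls , Rs) ∈ rightPremises F → All (_≺ F) (Ls ++ Rs)
  rightPremise-≺ {F = _ ∧ _} (here refl)         = ∧ˡ ∷ []
  rightPremise-≺ {F = _ ∧ _} (there (here refl)) = ∧ʳ ∷ []
  rightPremise-≺ {F = _ ∨ _} (here refl)         = ∨ˡ ∷ ∨ʳ ∷ []
  rightPremise-≺ {F = _ ⇒ _} (here refl)         = ⇒ˡ ∷ ⇒ʳ ∷ []
  rightPremise-≺ {F = ¬' _}  (here refl)         = ¬-body ∷ []

  private
    a+0<1+a+b : ∀ a b → a + 0 < suc (a + b)
    a+0<1+a+b a b rewrite +-identityʳ a = s≤s (m≤m+n a b)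
    b+0<1+a+b : ∀ a b → b + 0 < suc (a + b)
    b+0<1+a+b a b rewrite +-identityʳ b = s≤s (m≤n+m b a)
    a+b+0<1+a+b : ∀ a b → a + (b + 0) < suc (a + b)
    a+b+0<1+a+b a b rewrite +-identityʳ b = ≤-refl
    a+0<1+a : ∀ a → a + 0 < suc a
    a+0<1+a a rewrite +-identityʳ a = ≤-refl

  leftPremise-weight : (Ls , Rs) ∈ leftPremises F → weight (Ls ++ Rs) < size F
  leftPremise-weight {F = A ∧ B} (here refl)         = a+b+0<1+a+b (size A) (size B)
  leftPremise-weight {F = A ∨ B} (here refl)         = a+0<1+a+b (size A) (size B)
  leftPremise-weight {F = A ∨ B} (there (here refl)) = b+0<1+a+b (size A) (size B)
  leftPremise-weight {F = A ⇒ B} (here refl)         = a+0<1+a+b (size A) (size B)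
  leftPremise-weight {F = A ⇒ B} (there (here refl)) = b+0<1+a+b (size A) (size B)
  leftPremise-weight {F = ¬' A}  (here refl)         = a+0<1+a (size A)

  rightPremise-weight : (Ls , Rs) ∈ rightPremises F → weight (Ls ++ Rs) < size F
  rightPremise-weight {F = A ∧ B} (here refl)         = a+0<1+a+b (size A) (size B)
  rightPremise-weight {F = A ∧ B} (there (here refl)) = b+0<1+a+b (size A) (size B)
  rightPremise-weight {F = A ∨ B} (here refl)         = a+b+0<1+a+b (size A) (size B)
  rightPremise-weight {F = A ⇒ B} (here refl)         = a+b+0<1+a+b (size A) (size B)
  rightPremise-weight {F = ¬' A}  (here refl)         = a+0<1+a (size A)

  size≤weight : G ∈ X → size G ≤ weight X
  size≤weight {X = F ∷ X} (here refl) = m≤m+n (size F) (weight X)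
  size≤weight {X = F ∷ X} (there G∈X) = ≤-trans (size≤weight G∈X) (m≤n+m (weight X) (size F))

  leftRule : Compound F → (∀ {Ls Rs} → (Ls , Rs) ∈ leftPremises F → Ls ++ X ⊢ Rs ++ Y) → F ∷ X ⊢ Y
  leftRule c∧ prem = L∧ (prem (here refl))
  leftRule c∨ prem = L∨ (prem (here refl)) (prem (there (here refl)))
  leftRule c⇒ prem = L⇒ (prem (here refl)) (prem (there (here refl)))
  leftRule c¬ prem = L¬ (prem (here refl))

  rightRule : Compound F → (∀ {Ls Rs} → (Ls , Rs) ∈ rightPremises F → Ls ++ X ⊢ Rs ++ Y) → X ⊢ F ∷ Y
  rightRule c∧ prem = R∧ (prem (here refl)) (prem (there (here refl)))
  rightRule c∨ prem = R∨ (prem (here refl))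
  rightRule c⇒ prem = R⇒ (prem (here refl))
  rightRule c¬ prem = R¬ (prem (here refl))

  T-⊑ : ∀ Θ Γ → (□ i B ∷ Θ) ++ (B ∷ Γ) ⊑ Θ ++ (□ i B ∷ Γ)
  T-⊑ Θ Γ = ⊑-trans (↭⇒⊑ (↭-trans (prep _ (shift _ Θ Γ)) (swap _ _ ↭-refl)))
                    (⊑-++ (≺⇒⊑ (□-body ∷ []) (∈-++⁺ʳ Θ (here refl))) (↭⇒⊑ (↭-sym (shift _ Θ Γ))))

  leftStep-⊑ : ∀ Θ Γ Y Z → (Ls , Rs) ∈ leftPremises F →
               Θ ++ (Ls ++ Γ) ++ Y ++ (Rs ++ Z) ⊑ Θ ++ (F ∷ Γ) ++ Y ++ Z
  leftStep-⊑ {Ls = Ls} {Rs = Rs} Θ Γ Y Z r =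
    ⊑-replace (leftPremise-≺ r)
      (solve 6 (λ t l g y r z → t ⊕ (l ⊕ g) ⊕ y ⊕ (r ⊕ z) ⊜ (l ⊕ r) ⊕ t ⊕ g ⊕ y ⊕ z)
               ↭-refl Θ Ls Γ Y Rs Z)
      (shift _ Θ (Γ ++ Y ++ Z))

  rightStep-⊑ : ∀ Θ Y Z → (Ls , Rs) ∈ rightPremises F →
                Θ ++ Ls ++ Y ++ (Rs ++ Z) ⊑ Θ ++ [] ++ Y ++ (F ∷ Z)
  rightStep-⊑ {Ls = Ls} {Rs = Rs} Θ Y Z r =
    ⊑-replace (rightPremise-≺ r)
      (solve 5 (λ t l y r z → t ⊕ l ⊕ y ⊕ (r ⊕ z) ⊜ (l ⊕ r) ⊕ t ⊕ y ⊕ z) ↭-refl Θ Ls Y Rs Z)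
      (solve 4 (λ t y f z → t ⊕ y ⊕ f ⊕ z ⊜ f ⊕ t ⊕ y ⊕ z) ↭-refl Θ Y [ _ ] Z)

  unbox : Fin n → Fm n → Seq n
  unbox i (□ j C) with j ≟ᶠ i
  ... | yes _ = C ∷ []
  ... | no  _ = []
  unbox i _ = []

  boxes : Fin n → Seq n → Seq n
  boxes i = concatMap (unbox i)

  unbox-□ : ∀ i C → unbox i (□ i C) ≡ C ∷ []
  unbox-□ i C with i ≟ᶠ i
  ... | yes _ = refl
  ... | no i≢i = ⊥-elim (i≢i refl)

  unbox-side : SideL i F → unbox i F ≡ []
  unbox-side (sl-var q) = refl
  unbox-side sl-bot = refl
  unbox-side {i} (sl-box j B j≢i) with j ≟ᶠ i
  ... | yes j≡i = ⊥-elim (j≢i j≡i)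
  ... | no  _   = refl

  data BoxView (i : Fin n) : Fm n → Set where
    box   : ∀ C → BoxView i (□ i C)
    other : unbox i F ≡ [] → BoxView i F

  boxView : ∀ i F → BoxView i F
  boxView i (□ j C) with j ≟ᶠ i
  ... | yes refl = box C
  ... | no  j≢i  = other (unbox-side (sl-box j C j≢i))
  boxView i (var _) = other refl
  boxView i bot     = other refl
  boxView i (_ ∧ _) = other refl
  boxView i (_ ∨ _) = other refl
  boxView i (_ ⇒ _) = other refl
  boxView i (¬' _)  = other refl

  boxes-++ : ∀ i X Y → boxes i (X ++ Y) ≡ boxes i X ++ boxes i Y
  boxes-++ i X Y = trans (cong concat (map-++ (unbox i) X Y)) (sym (concat-++ (map (unbox i) X) (map (unbox i) Y)))

  boxes-↭ : ∀ i → X ↭ Y → boxes i X ↭ boxes i Y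
  boxes-↭ i ↭.refl          = ↭-refl
  boxes-↭ i (↭.prep F π)    = ++⁺ˡ (unbox i F) (boxes-↭ i π)
  boxes-↭ i (↭.swap F G π)  =
    ↭-trans (++⁺ˡ (unbox i F) (++⁺ˡ (unbox i G) (boxes-↭ i π))) (shifts (unbox i F) (unbox i G))
  boxes-↭ i (↭.trans π π′)  = ↭-trans (boxes-↭ i π) (boxes-↭ i π′)

  boxes-map-□ : ∀ i X → boxes i (map (□ i) X) ≡ X
  boxes-map-□ i []      = refl
  boxes-map-□ i (C ∷ X) rewrite unbox-□ i C = cong (C ∷_) (boxes-map-□ i X)

  boxes-□ : ∀ i C X → boxes i (□ i C ∷ X) ≡ C ∷ boxes i X
  boxes-□ i C X rewrite unbox-□ i C = refl

  boxes-side : All (SideL i) S → boxes i S ≡ []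
  boxes-side []           = refl
  boxes-side (s ∷ sides) rewrite unbox-side s = boxes-side sides

  ∈-boxes : ∀ i X → C ∈ boxes i X → □ i C ∈ X
  ∈-boxes i (F ∷ X) C∈ with boxView i F | ∈-++⁻ (unbox i F) C∈
  ... | box C′ | inj₁ C∈unbox rewrite unbox-□ i C′ with C∈unbox
  ...   | here refl = here refl
  ∈-boxes i (F ∷ X) C∈ | other u | inj₁ C∈unbox rewrite u with C∈unbox
  ... | ()
  ∈-boxes i (F ∷ X) C∈ | _ | inj₂ C∈boxes = there (∈-boxes i X C∈boxes)

  boxes-⊑ : ∀ i X → boxes i X ⊑ X
  boxes-⊑ i X C∈ = ≺⇒⊑ (□-body ∷ []) (∈-boxes i X C∈) (here refl)

  boxes-depth : ∀ i → All (λ F → depth F ≤ suc d) X → All (λ F → depth F ≤ d) (boxes i X)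
  boxes-depth {X = X} i bounded = All.tabulate λ C∈ → ≤-pred (All.lookup bounded (∈-boxes i X C∈))

  no-boxes : ∀ i → All (λ F → depth F ≤ 0) X → boxes i X ≡ []
  no-boxes i [] = refl
  no-boxes {X = F ∷ X} i (F≤0 ∷ bounded) with boxView i F
  ... | box C   with () ← F≤0
  ... | other u rewrite u = no-boxes i bounded

  data KnLeft (i : Fin n) : Fm n → Set where
    side : SideL i F → KnLeft i F
    box  : KnLeft i (□ i C)

  SideR⇒KnLeft : ∀ i → SideR F → KnLeft i F
  SideR⇒KnLeft i (sr-var q) = side (sl-var q)
  SideR⇒KnLeft i sr-bot     = side sl-bot
  SideR⇒KnLeft i (sr-box j B) with j ≟ᶠ i
  ... | yes refl = box
  ... | no  j≢i  = side (sl-box j B j≢i)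

  KnLeft-split : All (KnLeft i) X → ∃[ S ] (All (SideL i) S × X ↭ S ++ map (□ i) (boxes i X))
  KnLeft-split [] = [] , [] , ↭-refl
  KnLeft-split (side s ∷ ok) rewrite unbox-side s with S , sides , π ← KnLeft-split ok =
    _ ∷ S , s ∷ sides , prep _ π
  KnLeft-split {i} (box {C} ∷ ok) rewrite unbox-□ i C with S , sides , π ← KnLeft-split ok =
    S , sides , ↭-trans (prep _ π) (↭-sym (shift _ S _))

  KnLeft-intro : ∀ i X → All (SideL i) S → All (KnLeft i) (S ++ map (□ i) X)
  KnLeft-intro i []      []          = []
  KnLeft-intro i (C ∷ X) []          = box ∷ KnLeft-intro i X []
  KnLeft-intro i X       (s ∷ sides) = side s ∷ KnLeft-intro i X sides

  -- A height-bounded calculus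

  infix 4 _⊢[_]_

  data _⊢[_]_ : Seq n → ℕ → Seq n → Set where
    ax    : ∀ q → var q ∈ X → var q ∈ Y → X ⊢[ h ] Y
    ax⊥   : bot ∈ X → X ⊢[ h ] Y
    left  : Compound F → X ↭ F ∷ X₀ →
            (∀ {Ls Rs} → (Ls , Rs) ∈ leftPremises F → Ls ++ X₀ ⊢[ h ] Rs ++ Y) → X ⊢[ suc h ] Y
    right : Compound F → Y ↭ F ∷ Y₀ →
            (∀ {Ls Rs} → (Ls , Rs) ∈ rightPremises F → Ls ++ X ⊢[ h ] Rs ++ Y₀) → X ⊢[ suc h ] Y
    T     : ∀ i → X ↭ □ i A ∷ X₀ → □ i A ∷ A ∷ X₀ ⊢[ h ] Y → X ⊢[ suc h ] Y
    K     : ∀ i → All (KnLeft i) X → All SideR Y₀ → Y ↭ □ i A ∷ Y₀ →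
            boxes i X ⊢[ h ] A ∷ [] → X ⊢[ suc h ] Y

  ⊢-mono : h ≤ h′ → X ⊢[ h ] Y → X ⊢[ h′ ] Y
  ⊢-mono _         (ax q x y)          = ax q x y
  ⊢-mono _         (ax⊥ x)             = ax⊥ x
  ⊢-mono (s≤s h≤h′) (left c π prem)    = left c π (⊢-mono h≤h′ ∘ prem)
  ⊢-mono (s≤s h≤h′) (right c π prem)   = right c π (⊢-mono h≤h′ ∘ prem)
  ⊢-mono (s≤s h≤h′) (T i π e)          = T i π (⊢-mono h≤h′ e)
  ⊢-mono (s≤s h≤h′) (K i ok sides π e) = K i ok sides π (⊢-mono h≤h′ e)

  ⊢-resp-↭ : X ↭ X′ → Y ↭ Y′ → X ⊢[ h ] Y → X′ ⊢[ h ] Y′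
  ⊢-resp-↭ πX πY (ax q x y)          = ax q (∈-resp-↭ πX x) (∈-resp-↭ πY y)
  ⊢-resp-↭ πX πY (ax⊥ x)             = ax⊥ (∈-resp-↭ πX x)
  ⊢-resp-↭ πX πY (left c π prem)     = left c (↭-trans (↭-sym πX) π) (⊢-resp-↭ ↭-refl (++⁺ˡ _ πY) ∘ prem)
  ⊢-resp-↭ πX πY (right c π prem)    = right c (↭-trans (↭-sym πY) π) (⊢-resp-↭ (++⁺ˡ _ πX) ↭-refl ∘ prem)
  ⊢-resp-↭ πX πY (T i π e)           = T i (↭-trans (↭-sym πX) π) (⊢-resp-↭ ↭-refl πY e)
  ⊢-resp-↭ πX πY (K i ok sides π e)  =
    K i (All-resp-↭ πX ok) sides (↭-trans (↭-sym πY) π) (⊢-resp-↭ (boxes-↭ i πX) ↭-refl e)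

  K⊢ : ∀ i → All (KnLeft i) X → All SideR Y₀ → boxes i X ⊢ A ∷ [] → X ⊢ □ i A ∷ Y₀
  K⊢ i ok sides d with S , sidesS , πX ← KnLeft-split ok = perm (↭-sym πX) ↭-refl (□Kn i sidesS sides d)

  ⊢[]⇒⊢ : X ⊢[ h ] Y → X ⊢ Y
  ⊢[]⇒⊢ (ax q x y) with _ , πX ← ∈⇒↭∷ x | _ , πY ← ∈⇒↭∷ y = perm (↭-sym πX) (↭-sym πY) (init q)
  ⊢[]⇒⊢ (ax⊥ x) with _ , πX ← ∈⇒↭∷ x = perm (↭-sym πX) ↭-refl botL
  ⊢[]⇒⊢ (left c π prem)  = perm (↭-sym π) ↭-refl (leftRule c (⊢[]⇒⊢ ∘ prem))
  ⊢[]⇒⊢ (right c π prem) = perm ↭-refl (↭-sym π) (rightRule c (⊢[]⇒⊢ ∘ prem))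
  ⊢[]⇒⊢ (T i π e)        = perm (↭-sym π) ↭-refl (□Tn i (⊢[]⇒⊢ e))
  ⊢[]⇒⊢ (K i ok sides π e) = perm ↭-refl (↭-sym π) (K⊢ i ok sides (⊢[]⇒⊢ e))

  private
    ⊢-⊔ : X ⊢[ h ] Y → X′ ⊢[ h′ ] Y′ → X ⊢[ h ⊔ h′ ] Y × X′ ⊢[ h ⊔ h′ ] Y′
    ⊢-⊔ {h = h} {h′ = h′} e e′ = ⊢-mono (m≤m⊔n h h′) e , ⊢-mono (m≤n⊔m h h′) e′

  ⊢⇒⊢[] : X ⊢ Y → ∃[ h ] X ⊢[ h ] Y
  ⊢⇒⊢[] (perm πX πY d) = let h , e = ⊢⇒⊢[] d in h , ⊢-resp-↭ πX πY e
  ⊢⇒⊢[] (init q) = 0 , ax q (here refl) (here refl)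
  ⊢⇒⊢[] botL     = 0 , ax⊥ (here refl)
  ⊢⇒⊢[] (R∧ d₁ d₂) =
    let h₁ , e₁ = ⊢⇒⊢[] d₁ ; h₂ , e₂ = ⊢⇒⊢[] d₂ ; e₁′ , e₂′ = ⊢-⊔ e₁ e₂ in
    suc (h₁ ⊔ h₂) , right c∧ ↭-refl λ { (here refl) → e₁′ ; (there (here refl)) → e₂′ }
  ⊢⇒⊢[] (L∧ d) = let h , e = ⊢⇒⊢[] d in suc h , left c∧ ↭-refl λ { (here refl) → e }
  ⊢⇒⊢[] (R∨ d) = let h , e = ⊢⇒⊢[] d in suc h , right c∨ ↭-refl λ { (here refl) → e }
  ⊢⇒⊢[] (L∨ d₁ d₂) =
    let h₁ , e₁ = ⊢⇒⊢[] d₁ ; h₂ , e₂ = ⊢⇒⊢[] d₂ ; e₁′ , e₂′ = ⊢-⊔ e₁ e₂ in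
    suc (h₁ ⊔ h₂) , left c∨ ↭-refl λ { (here refl) → e₁′ ; (there (here refl)) → e₂′ }
  ⊢⇒⊢[] (R⇒ d) = let h , e = ⊢⇒⊢[] d in suc h , right c⇒ ↭-refl λ { (here refl) → e }
  ⊢⇒⊢[] (L⇒ d₁ d₂) =
    let h₁ , e₁ = ⊢⇒⊢[] d₁ ; h₂ , e₂ = ⊢⇒⊢[] d₂ ; e₁′ , e₂′ = ⊢-⊔ e₁ e₂ in
    suc (h₁ ⊔ h₂) , left c⇒ ↭-refl λ { (here refl) → e₁′ ; (there (here refl)) → e₂′ }
  ⊢⇒⊢[] (R¬ d) = let h , e = ⊢⇒⊢[] d in suc h , right c¬ ↭-refl λ { (here refl) → e }
  ⊢⇒⊢[] (L¬ d) = let h , e = ⊢⇒⊢[] d in suc h , left c¬ ↭-refl λ { (here refl) → e }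
  ⊢⇒⊢[] (□Kn {Γ = Γ} {Σ = Σ} i sides sidesR d) =
    let h , e = ⊢⇒⊢[] d in
    suc h , K i (KnLeft-intro i Γ sides) sidesR ↭-refl (subst (_⊢[ h ] _) (sym boxes-premise) e)
    where
    boxes-premise : boxes i (Σ ++ map (□ i) Γ) ≡ Γ
    boxes-premise rewrite boxes-++ i Σ (map (□ i) Γ) | boxes-side sides | boxes-map-□ i Γ = refl
  ⊢⇒⊢[] (□Tn i d) = let h , e = ⊢⇒⊢[] d in suc h , T i ↭-refl e

  ax⊢ : var q ∈ X → var q ∈ Y → X ⊢ Y
  ax⊢ x y = ⊢[]⇒⊢ (ax {h = 0} _ x y)

  ax⊥⊢ : bot ∈ X → X ⊢ Y
  ax⊥⊢ x = ⊢[]⇒⊢ (ax⊥ {h = 0} x)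

  -- Height-preserving inversion and contraction

  compound-¬atomic : Compound F → SideR F → ⊥
  compound-¬atomic c∧ ()
  compound-¬atomic c∨ ()
  compound-¬atomic c⇒ ()
  compound-¬atomic c¬ ()

  compound-¬KnLeft : Compound F → KnLeft i F → ⊥
  compound-¬KnLeft c∧ (side ())
  compound-¬KnLeft c∨ (side ())
  compound-¬KnLeft c⇒ (side ())
  compound-¬KnLeft c¬ (side ())

  ∈-behind-compound : Compound F → SideR G → G ∈ F ∷ X → G ∈ X
  ∈-behind-compound c a (here refl) = ⊥-elim (compound-¬atomic c a)
  ∈-behind-compound c a (there G∈X) = G∈X

  invertˡ : Compound F → (Ls , Rs) ∈ leftPremises F → X ↭ F ∷ X₀ →
            X ⊢[ h ] Y → Ls ++ X₀ ⊢[ h ] Rs ++ Y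
  invertˡ {Ls = Ls} {Rs = Rs} c r π (ax q x y) =
    ax q (∈-++⁺ʳ Ls (∈-behind-compound c (sr-var q) (∈-resp-↭ π x))) (∈-++⁺ʳ Rs y)
  invertˡ {Ls = Ls} c r π (ax⊥ x) = ax⊥ (∈-++⁺ʳ Ls (∈-behind-compound c sr-bot (∈-resp-↭ π x)))
  invertˡ {Ls = Ls} {Rs = Rs} c r π (left c′ π′ prem) with ↭-∷-inv π′ π
  ... | inj₁ (refl , X₁↭X₀) = ⊢-mono (n≤1+n _) (⊢-resp-↭ (++⁺ˡ Ls X₁↭X₀) ↭-refl (prem r))
  ... | inj₂ (X₂ , X₁↭ , X₀↭) =
    left c′ (↭-trans (++⁺ˡ Ls X₀↭) (shift _ Ls X₂)) λ {Ls′} {Rs′} r′ →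
      ⊢-resp-↭ (shifts Ls Ls′) (shifts Rs Rs′)
        (invertˡ c r (↭-trans (++⁺ˡ Ls′ X₁↭) (shift _ Ls′ X₂)) (prem r′))
  invertˡ {Ls = Ls} {Rs = Rs} {X₀ = X₀} c r π (right {Y₀ = Y₀} c′ π′ prem) =
    right c′ (↭-trans (++⁺ˡ Rs π′) (shift _ Rs Y₀)) λ {Ls′} {Rs′} r′ →
      ⊢-resp-↭ (shifts Ls Ls′) (shifts Rs Rs′)
        (invertˡ c r (↭-trans (++⁺ˡ Ls′ π) (shift _ Ls′ X₀)) (prem r′))
  invertˡ {Ls = Ls} c r π (T {A = A} i π′ e) with ↭-∷-inv π′ π
  invertˡ () r π (T i π′ e) | inj₁ (refl , _)
  ... | inj₂ (X₂ , X₁↭ , X₀↭) =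
    T i (↭-trans (++⁺ˡ Ls X₀↭) (shift _ Ls X₂))
      (⊢-resp-↭ (shifts Ls (□ i A ∷ A ∷ [])) ↭-refl
        (invertˡ c r (↭-trans (prep _ (prep _ X₁↭)) (shift _ (□ i A ∷ A ∷ []) X₂)) e))
  invertˡ c r π (K i ok sides π′ e) =
    ⊥-elim (compound-¬KnLeft c (All.lookup ok (∈-resp-↭ (↭-sym π) (here refl))))

  invertʳ : Compound F → (Ls , Rs) ∈ rightPremises F → Y ↭ F ∷ Y₀ →
            X ⊢[ h ] Y → Ls ++ X ⊢[ h ] Rs ++ Y₀
  invertʳ {Ls = Ls} {Rs = Rs} c r π (ax q x y) =
    ax q (∈-++⁺ʳ Ls x) (∈-++⁺ʳ Rs (∈-behind-compound c (sr-var q) (∈-resp-↭ π y)))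
  invertʳ {Ls = Ls} c r π (ax⊥ x) = ax⊥ (∈-++⁺ʳ Ls x)
  invertʳ {Ls = Ls} {Rs = Rs} {Y₀ = Y₀} c r π (left {X₀ = X₁} c′ π′ prem) =
    left c′ (↭-trans (++⁺ˡ Ls π′) (shift _ Ls X₁)) λ {Ls′} {Rs′} r′ →
      ⊢-resp-↭ (shifts Ls Ls′) (shifts Rs Rs′)
        (invertʳ c r (↭-trans (++⁺ˡ Rs′ π) (shift _ Rs′ Y₀)) (prem r′))
  invertʳ {Ls = Ls} {Rs = Rs} c r π (right c′ π′ prem) with ↭-∷-inv π′ π
  ... | inj₁ (refl , Y₁↭Y₀) = ⊢-mono (n≤1+n _) (⊢-resp-↭ ↭-refl (++⁺ˡ Rs Y₁↭Y₀) (prem r))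
  ... | inj₂ (Y₂ , Y₁↭ , Y₀↭) =
    right c′ (↭-trans (++⁺ˡ Rs Y₀↭) (shift _ Rs Y₂)) λ {Ls′} {Rs′} r′ →
      ⊢-resp-↭ (shifts Ls Ls′) (shifts Rs Rs′)
        (invertʳ c r (↭-trans (++⁺ˡ Rs′ Y₁↭) (shift _ Rs′ Y₂)) (prem r′))
  invertʳ {Ls = Ls} c r π (T {A = A} {X₀ = X₁} i π′ e) =
    T i (↭-trans (++⁺ˡ Ls π′) (shift _ Ls X₁))
      (⊢-resp-↭ (shifts Ls (□ i A ∷ A ∷ [])) ↭-refl (invertʳ c r π e))
  invertʳ c r π (K i ok sides π′ e) with ∈-resp-↭ (↭-trans (↭-sym π) π′) (here refl)
  ... | here refl = ⊥-elim (compound-¬atomic c (sr-box i _))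
  ... | there F∈Y₁ = ⊥-elim (compound-¬atomic c (All.lookup sides F∈Y₁))

  private
    ∈-dedup : G ∈ F ∷ F ∷ X → G ∈ F ∷ X
    ∈-dedup (here refl) = here refl
    ∈-dedup (there G∈) = G∈

    premise-sizes : weight (Ls ++ Rs) < size F → size F ≤ suc s →
                    All (λ G → size G ≤ s) Ls × All (λ G → size G ≤ s) Rs
    premise-sizes {Ls = Ls} {Rs = Rs} {F = F} {s = s} w<F F≤ =
      All.tabulate (bound ∘ ∈-++⁺ˡ) , All.tabulate (bound ∘ ∈-++⁺ʳ Ls)
      where
      bound : G ∈ Ls ++ Rs → size G ≤ s
      bound G∈ = ≤-pred (≤-trans (s≤s (size≤weight G∈)) (≤-trans w<F F≤))

  contractˡ  : size F ≤ s → X ↭ F ∷ F ∷ X₀ → X ⊢[ h ] Y → F ∷ X₀ ⊢[ h ] Y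
  contractʳ  : size F ≤ s → Y ↭ F ∷ F ∷ Y₀ → X ⊢[ h ] Y → X ⊢[ h ] F ∷ Y₀
  contractˡ* : All (λ G → size G ≤ s) Ls → Ls ++ Ls ++ X ⊢[ h ] Y → Ls ++ X ⊢[ h ] Y
  contractʳ* : All (λ G → size G ≤ s) Rs → X ⊢[ h ] Rs ++ Rs ++ Y → X ⊢[ h ] Rs ++ Y

  contractˡ* [] e = e
  contractˡ* {Ls = G ∷ Ls} {X = X} (G≤ ∷ Ls≤) e =
    ⊢-resp-↭ (shift G Ls X) ↭-refl
      (contractˡ* Ls≤ (⊢-resp-↭ (↭-trans (shifts (G ∷ []) Ls) (++⁺ˡ Ls (shifts (G ∷ []) Ls))) ↭-refl
        (contractˡ G≤ (prep G (shift G Ls (Ls ++ X))) e)))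

  contractʳ* [] e = e
  contractʳ* {Rs = G ∷ Rs} {Y = Y} (G≤ ∷ Rs≤) e =
    ⊢-resp-↭ ↭-refl (shift G Rs Y)
      (contractʳ* Rs≤ (⊢-resp-↭ ↭-refl (↭-trans (shifts (G ∷ []) Rs) (++⁺ˡ Rs (shifts (G ∷ []) Rs)))
        (contractʳ G≤ (prep G (shift G Rs (Rs ++ Y))) e)))

  contractˡ {F = F} {s = zero} F≤0 π e with () ← ≤-trans (0<size F) F≤0
  contractˡ {s = suc s} F≤ π (ax q x y) = ax q (∈-dedup (∈-resp-↭ π x)) y
  contractˡ {s = suc s} F≤ π (ax⊥ x)    = ax⊥ (∈-dedup (∈-resp-↭ π x))
  contractˡ {F = F} {s = suc s} {X₀ = X₀} F≤ π (left c π′ prem) with ↭-∷∷-inv π′ π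
  ... | inj₁ (refl , X₁↭) = left c ↭-refl λ {Ls} {Rs} r →
    let Ls≤ , Rs≤ = premise-sizes {Ls = Ls} {Rs = Rs} (leftPremise-weight r) F≤ in
    contractʳ* Rs≤ (contractˡ* Ls≤ (invertˡ c r (↭-trans (++⁺ˡ Ls X₁↭) (shift F Ls X₀)) (prem r)))
  ... | inj₂ (X₂ , X₁↭ , X₀↭) = left c (↭-trans (prep F X₀↭) (swap F _ ↭-refl)) λ {Ls} r →
    ⊢-resp-↭ (↭-sym (shift F Ls X₂)) ↭-refl
      (contractˡ F≤ (↭-trans (++⁺ˡ Ls X₁↭) (shifts Ls (F ∷ F ∷ []))) (prem r))
  contractˡ {F = F} {s = suc s} {X₀ = X₀} F≤ π (right c π′ prem) = right c π′ λ {Ls} r →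
    ⊢-resp-↭ (↭-sym (shift F Ls X₀)) ↭-refl
      (contractˡ F≤ (↭-trans (++⁺ˡ Ls π) (shifts Ls (F ∷ F ∷ []))) (prem r))
  contractˡ {F = F} {s = suc s} F≤ π (T {A = A} i π′ e) with ↭-∷∷-inv π′ π
  ... | inj₁ (refl , X₁↭) =
    T i ↭-refl (contractˡ F≤ (prep F (↭-trans (prep A X₁↭) (swap A F ↭-refl))) e)
  ... | inj₂ (X₂ , X₁↭ , X₀↭) =
    T i (↭-trans (prep F X₀↭) (swap F _ ↭-refl))
      (⊢-resp-↭ (↭-sym (shift F (□ i A ∷ A ∷ []) X₂)) ↭-refl
        (contractˡ F≤ (↭-trans (prep _ (prep _ X₁↭)) (shifts (□ i A ∷ A ∷ []) (F ∷ F ∷ []))) e))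
  contractˡ {F = F} {s = suc s} {X₀ = X₀} F≤ π (K i ok sides π′ e) with All-resp-↭ π ok
  ... | _ ∷ ok′ = K i ok′ sides π′ (contract-unbox F F≤ (⊢-resp-↭ (boxes-↭ i π) ↭-refl e))
    where
    contract-unbox : ∀ F → size F ≤ suc s →
                     unbox i F ++ unbox i F ++ Z ⊢[ h ] Y → unbox i F ++ Z ⊢[ h ] Y
    contract-unbox F F≤ e with boxView i F
    ... | box C   rewrite unbox-□ i C = contractˡ (≤-pred F≤) ↭-refl e
    ... | other u rewrite u = e

  contractʳ {F = F} {s = zero} F≤0 π e with () ← ≤-trans (0<size F) F≤0
  contractʳ {s = suc s} F≤ π (ax q x y) = ax q x (∈-dedup (∈-resp-↭ π y))
  contractʳ {s = suc s} F≤ π (ax⊥ x)    = ax⊥ x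
  contractʳ {F = F} {s = suc s} {Y₀ = Y₀} F≤ π (left c π′ prem) = left c π′ λ {_} {Rs} r →
    ⊢-resp-↭ ↭-refl (↭-sym (shift F Rs Y₀))
      (contractʳ F≤ (↭-trans (++⁺ˡ Rs π) (shifts Rs (F ∷ F ∷ []))) (prem r))
  contractʳ {F = F} {s = suc s} {Y₀ = Y₀} F≤ π (right c π′ prem) with ↭-∷∷-inv π′ π
  ... | inj₁ (refl , Y₁↭) = right c ↭-refl λ {Ls} {Rs} r →
    let Ls≤ , Rs≤ = premise-sizes {Ls = Ls} {Rs = Rs} (rightPremise-weight r) F≤ in
    contractʳ* Rs≤ (contractˡ* Ls≤ (invertʳ c r (↭-trans (++⁺ˡ Rs Y₁↭) (shift F Rs Y₀)) (prem r)))
  ... | inj₂ (Y₂ , Y₁↭ , Y₀↭) = right c (↭-trans (prep F Y₀↭) (swap F _ ↭-refl)) λ {_} {Rs} r →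
    ⊢-resp-↭ ↭-refl (↭-sym (shift F Rs Y₂))
      (contractʳ F≤ (↭-trans (++⁺ˡ Rs Y₁↭) (shifts Rs (F ∷ F ∷ []))) (prem r))
  contractʳ {s = suc s} F≤ π (T i π′ e) = T i π′ (contractʳ F≤ π e)
  contractʳ {F = F} {s = suc s} F≤ π (K i ok sides π′ e) with ↭-∷∷-inv π′ π
  ... | inj₁ (refl , Y₁↭) with All-resp-↭ Y₁↭ sides
  ...   | _ ∷ sides′ = K i ok sides′ ↭-refl e
  contractʳ {F = F} {s = suc s} F≤ π (K i ok sides π′ e) | inj₂ (Y₂ , Y₁↭ , Y₀↭)
    with All-resp-↭ Y₁↭ sides
  ...   | F-side ∷ _ ∷ sides′ = K i ok (F-side ∷ sides′) (↭-trans (prep F Y₀↭) (swap F _ ↭-refl)) e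

  contractˡ-∈ : C ∈ X → C ∷ X ⊢[ h ] Y → X ⊢[ h ] Y
  contractˡ-∈ {C = C} C∈X e with _ , π ← ∈⇒↭∷ C∈X =
    ⊢-resp-↭ (↭-sym π) ↭-refl (contractˡ {s = size C} ≤-refl (prep C π) e)

  contractʳ-∈ : C ∈ Y → X ⊢[ h ] C ∷ Y → X ⊢[ h ] Y
  contractʳ-∈ {C = C} C∈Y e with _ , π ← ∈⇒↭∷ C∈Y =
    ⊢-resp-↭ ↭-refl (↭-sym π) (contractʳ {s = size C} ≤-refl (prep C π) e)

  weakenʳ-atom : SideR C → X ⊢[ h ] Y → X ⊢[ h ] C ∷ Y
  weakenʳ-atom a (ax q x y) = ax q x (there y)
  weakenʳ-atom a (ax⊥ x)    = ax⊥ x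
  weakenʳ-atom {C = C} {Y = Y} a (left c π prem) =
    left c π λ {_} {Rs} r → ⊢-resp-↭ ↭-refl (↭-sym (shift C Rs Y)) (weakenʳ-atom a (prem r))
  weakenʳ-atom {C = C} a (right {Y₀ = Y₀} c π prem) =
    right c (↭-trans (prep C π) (swap C _ ↭-refl)) λ {_} {Rs} r →
      ⊢-resp-↭ ↭-refl (↭-sym (shift C Rs Y₀)) (weakenʳ-atom a (prem r))
  weakenʳ-atom a (T i π e) = T i π (weakenʳ-atom a e)
  weakenʳ-atom {C = C} a (K i ok sides π e) = K i ok (a ∷ sides) (↭-trans (prep C π) (swap C _ ↭-refl)) e

  weakenˡ      : ∀ C → X ⊢ Y → C ∷ X ⊢ Y
  weakenʳ      : ∀ C → X ⊢ Y → X ⊢ C ∷ Y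
  weakenˡ-atom : SideR C → X ⊢[ h ] Y → C ∷ X ⊢ Y

  weakenˡ (var q) d = weakenˡ-atom (sr-var q) (proj₂ (⊢⇒⊢[] d))
  weakenˡ bot     d = weakenˡ-atom sr-bot (proj₂ (⊢⇒⊢[] d))
  weakenˡ (□ i B) d = weakenˡ-atom (sr-box i B) (proj₂ (⊢⇒⊢[] d))
  weakenˡ (A ∧ B) d = L∧ (weakenˡ A (weakenˡ B d))
  weakenˡ (A ∨ B) d = L∨ (weakenˡ A d) (weakenˡ B d)
  weakenˡ (A ⇒ B) d = L⇒ (weakenʳ A d) (weakenˡ B d)
  weakenˡ (¬' A)  d = L¬ (weakenʳ A d)

  weakenʳ (var q) d = ⊢[]⇒⊢ (weakenʳ-atom (sr-var q) (proj₂ (⊢⇒⊢[] d)))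
  weakenʳ bot     d = ⊢[]⇒⊢ (weakenʳ-atom sr-bot (proj₂ (⊢⇒⊢[] d)))
  weakenʳ (□ i B) d = ⊢[]⇒⊢ (weakenʳ-atom (sr-box i B) (proj₂ (⊢⇒⊢[] d)))
  weakenʳ (A ∧ B) d = R∧ (weakenʳ A d) (weakenʳ B d)
  weakenʳ (A ∨ B) d = R∨ (weakenʳ A (weakenʳ B d))
  weakenʳ (A ⇒ B) d = R⇒ (weakenˡ A (weakenʳ B d))
  weakenʳ (¬' A)  d = R¬ (weakenˡ A d)

  weakenˡ-atom a (ax q x y) = ax⊢ (there x) y
  weakenˡ-atom a (ax⊥ x)    = ax⊥⊢ (there x)
  weakenˡ-atom {C = C} a (left {X₀ = X₀} c π prem) =
    perm (↭-sym (↭-trans (prep C π) (swap C _ ↭-refl))) ↭-refl (leftRule c λ {Ls} r →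
      perm (↭-sym (shift C Ls X₀)) ↭-refl (weakenˡ-atom a (prem r)))
  weakenˡ-atom {C = C} {X = X} a (right c π prem) =
    perm ↭-refl (↭-sym π) (rightRule c λ {Ls} r →
      perm (↭-sym (shift C Ls X)) ↭-refl (weakenˡ-atom a (prem r)))
  weakenˡ-atom {C = C} a (T {A = A} {X₀ = X₀} i π e) =
    perm (↭-sym (↭-trans (prep C π) (swap C _ ↭-refl))) ↭-refl
      (□Tn i (perm (↭-sym (shift C (□ i A ∷ A ∷ []) X₀)) ↭-refl (weakenˡ-atom a e)))
  weakenˡ-atom {C = C} {X = X} a (K {A = A} i ok sides π e) =
    perm ↭-refl (↭-sym π) (K⊢ i (SideR⇒KnLeft i a ∷ ok) sides (weaken-unbox (boxView i C) (⊢[]⇒⊢ e)))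
    where
    weaken-unbox : BoxView i C → boxes i X ⊢ A ∷ [] → unbox i C ++ boxes i X ⊢ A ∷ []
    weaken-unbox (box B)   d rewrite unbox-□ i B = weakenˡ B d
    weaken-unbox (other u) d rewrite u = d

  data Absorbed (M N : Seq n) : Seq n → Seq n → Set where
    []      : Absorbed M N [] []
    memberˡ : C ∈ M → Absorbed M N Ls Rs → Absorbed M N (C ∷ Ls) Rs
    memberʳ : C ∈ N → Absorbed M N Ls Rs → Absorbed M N Ls (C ∷ Rs)
    ruleˡ   : Compound C → (Ls′ , Rs′) ∈ leftPremises C →
              Absorbed M N (Ls′ ++ Ls) (Rs′ ++ Rs) → Absorbed M N (C ∷ Ls) Rs
    ruleʳ   : Compound C → (Ls′ , Rs′) ∈ rightPremises C →
              Absorbed M N (Ls′ ++ Ls) (Rs′ ++ Rs) → Absorbed M N Ls (C ∷ Rs)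

  absorb : Absorbed M N Ls Rs → M ⊆ X → N ⊆ Y → Ls ++ X ⊢[ h ] Rs ++ Y → X ⊢[ h ] Y
  absorb [] M⊆X N⊆Y e = e
  absorb {Ls = _ ∷ Ls} (memberˡ C∈M a) M⊆X N⊆Y e =
    absorb a M⊆X N⊆Y (contractˡ-∈ (∈-++⁺ʳ Ls (M⊆X C∈M)) e)
  absorb {Rs = _ ∷ Rs} (memberʳ C∈N a) M⊆X N⊆Y e =
    absorb a M⊆X N⊆Y (contractʳ-∈ (∈-++⁺ʳ Rs (N⊆Y C∈N)) e)
  absorb {Ls = _ ∷ Ls} {Rs = Rs} {X = X} {Y = Y} (ruleˡ {Ls′ = Ls′} {Rs′ = Rs′} c r a) M⊆X N⊆Y e =
    absorb a M⊆X N⊆Y (⊢-resp-↭ (↭-reflexive (sym (++-assoc Ls′ Ls X))) (↭-reflexive (sym (++-assoc Rs′ Rs Y)))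
                                (invertˡ c r ↭-refl e))
  absorb {Ls = Ls} {Rs = _ ∷ Rs} {X = X} {Y = Y} (ruleʳ {Ls′ = Ls′} {Rs′ = Rs′} c r a) M⊆X N⊆Y e =
    absorb a M⊆X N⊆Y (⊢-resp-↭ (↭-reflexive (sym (++-assoc Ls′ Ls X))) (↭-reflexive (sym (++-assoc Rs′ Rs Y)))
                                (invertʳ c r ↭-refl e))

  Absorbed-members : Ls ⊆ M → Rs ⊆ N → Absorbed M N Ls Rs
  Absorbed-members {Ls = []}     {Rs = []}     _ _ = []
  Absorbed-members {Ls = []}     {Rs = C ∷ Rs} _    Rs⊆N =
    memberʳ (Rs⊆N (here refl)) (Absorbed-members (λ ()) (Rs⊆N ∘ there))
  Absorbed-members {Ls = C ∷ Ls}                Ls⊆M Rs⊆N =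
    memberˡ (Ls⊆M (here refl)) (Absorbed-members (Ls⊆M ∘ there) Rs⊆N)

  Absorbed-++ : Absorbed M N Ls Rs → Absorbed M N Ls′ Rs′ → Absorbed M N (Ls ++ Ls′) (Rs ++ Rs′)
  Absorbed-++ [] b = b
  Absorbed-++ (memberˡ C∈M a) b = memberˡ C∈M (Absorbed-++ a b)
  Absorbed-++ (memberʳ C∈N a) b = memberʳ C∈N (Absorbed-++ a b)
  Absorbed-++ {M = M} {N = N} {Ls = _ ∷ Ls} {Rs = Rs} {Ls′ = Ls₂} {Rs′ = Rs₂}
              (ruleˡ {Ls′ = Ls′} {Rs′ = Rs′} c r a) b =
    ruleˡ c r (subst₂ (Absorbed M N) (++-assoc Ls′ Ls Ls₂) (++-assoc Rs′ Rs Rs₂) (Absorbed-++ a b))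
  Absorbed-++ {M = M} {N = N} {Ls = Ls} {Rs = _ ∷ Rs} {Ls′ = Ls₂} {Rs′ = Rs₂}
              (ruleʳ {Ls′ = Ls′} {Rs′ = Rs′} c r a) b =
    ruleʳ c r (subst₂ (Absorbed M N) (++-assoc Ls′ Ls Ls₂) (++-assoc Rs′ Rs Rs₂) (Absorbed-++ a b))

  Absorbed-trans : (∀ {C} → C ∈ M → Absorbed M′ N′ (C ∷ []) []) →
                   (∀ {C} → C ∈ N → Absorbed M′ N′ [] (C ∷ [])) →
                   Absorbed M N Ls Rs → Absorbed M′ N′ Ls Rs
  Absorbed-trans f g []              = []
  Absorbed-trans f g (memberˡ C∈M a) = Absorbed-++ (f C∈M) (Absorbed-trans f g a)
  Absorbed-trans f g (memberʳ C∈N a) = Absorbed-++ (g C∈N) (Absorbed-trans f g a)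
  Absorbed-trans f g (ruleˡ c r a)   = ruleˡ c r (Absorbed-trans f g a)
  Absorbed-trans f g (ruleʳ c r a)   = ruleʳ c r (Absorbed-trans f g a)

  Absorbed-⊆ : M ⊆ M′ → N ⊆ N′ → Absorbed M N Ls Rs → Absorbed M′ N′ Ls Rs
  Absorbed-⊆ M⊆M′ N⊆N′ =
    Absorbed-trans (λ C∈M → memberˡ (M⊆M′ C∈M) []) (λ C∈N → memberʳ (N⊆N′ C∈N) [])

  ⊤′ : Fm n
  ⊤′ = ¬' bot

  ⋁ : Seq n → Fm n
  ⋁ []       = bot
  ⋁ (E ∷ Es) = E ∨ ⋁ Es

  ⋀ : Seq n → Fm n
  ⋀ []       = ⊤′
  ⋀ (E ∷ Es) = E ∧ ⋀ Es

  ⊤′-right : X ⊢ ⊤′ ∷ Y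
  ⊤′-right = R¬ botL

  ⋁-left : (∀ {E} → E ∈ Es → E ∷ X ⊢ Y) → ⋁ Es ∷ X ⊢ Y
  ⋁-left {Es = []}     each = botL
  ⋁-left {Es = E ∷ Es} each = L∨ (each (here refl)) (⋁-left (each ∘ there))

  ⋁-right : E ∈ Es → X ⊢ E ∷ Y → X ⊢ ⋁ Es ∷ Y
  ⋁-right {Es = _ ∷ Es} (here refl) d = R∨ (perm ↭-refl (swap _ _ ↭-refl) (weakenʳ (⋁ Es) d))
  ⋁-right {Es = E ∷ _}  (there E∈)  d = R∨ (weakenʳ E (⋁-right E∈ d))

  ⋀-left : E ∈ Es → E ∷ X ⊢ Y → ⋀ Es ∷ X ⊢ Y
  ⋀-left {Es = _ ∷ Es} (here refl) d = L∧ (perm (swap _ _ ↭-refl) ↭-refl (weakenˡ (⋀ Es) d))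
  ⋀-left {Es = E ∷ _}  (there E∈)  d = L∧ (weakenˡ E (⋀-left E∈ d))

  ⋀-right-map : ∀ {J : Set} (f : J → Fm n) js → (∀ {j} → j ∈ js → X ⊢ f j ∷ Y) → X ⊢ ⋀ (map f js) ∷ Y
  ⋀-right-map f []       each = ⊤′-right
  ⋀-right-map f (j ∷ js) each = R∧ (each (here refl)) (⋀-right-map f js (each ∘ there))

  ⋁-occ : Occ q (⋁ Es) → OccL q Es
  ⋁-occ {Es = _ ∷ _} (occ-∨l o) = here o
  ⋁-occ {Es = _ ∷ _} (occ-∨r o) = there (⋁-occ o)

  ⋀-map-occ : ∀ {J : Set} (f : J → Fm n) js → Occ q (⋀ (map f js)) → ∃[ j ] (j ∈ js × Occ q (f j))
  ⋀-map-occ f []       (occ-¬ ())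
  ⋀-map-occ f (j ∷ js) (occ-∧l o) = j , here refl , o
  ⋀-map-occ f (j ∷ js) (occ-∧r o) with j′ , j′∈ , o′ ← ⋀-map-occ f js o =
    j′ , there j′∈ , o′

  var-≟ : ∀ q (F : Fm n) → Dec (var q ≡ F)
  var-≟ q (var r) = map′ (cong var) (λ { refl → refl }) (q ≟ℕ r)
  var-≟ q bot     = no λ ()
  var-≟ q (_ ∧ _) = no λ ()
  var-≟ q (_ ∨ _) = no λ ()
  var-≟ q (_ ⇒ _) = no λ ()
  var-≟ q (¬' _)  = no λ ()
  var-≟ q (□ _ _) = no λ ()

  var-∈? : ∀ q (Ω : Seq n) → Dec (var q ∈ Ω)
  var-∈? q = Any.any? (var-≟ q)


module Interpolant {n : ℕ} (p : ℕ) where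
  private
    variable
      q : ℕ
      i : Fin n
      A B E F : Fm n
      X Y Θ Γ Ω Δ Π Λ Ls Rs : Seq n
      d w : ℕ
    open ↭-Solver (Fm n) using (solve; _⊕_; _⊜_; id)

  leftLiteral : Seq n → Fm n → Fm n
  leftLiteral Ω (var q) with var-∈? q Ω | q ≟ℕ p
  ... | yes _ | _     = ⊤′
  ... | no  _ | yes _ = bot
  ... | no  _ | no  _ = ¬' var q
  leftLiteral Ω bot = ⊤′
  leftLiteral Ω _   = bot

  -- interpolant d Γ Δ is A_p(Γ ; Δ) when d bounds the modal depth of Γ, Δ.  reduce d w Θ Γ Ω Δ
  -- interpolates Θ, Γ ⇒ Ω, Δ, where Θ and Ω keep the atoms and boxes already processed; the fuel w
  -- suffices once weight Γ + weight Δ ≤ w.  Where fuel or depth runs out the result is bot, which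
  -- completeness never uses.
  interpolant   : ℕ → Seq n → Seq n → Fm n
  reduce        : (d w : ℕ) (Θ Γ Ω Δ : Seq n) → Fm n
  critical      : ℕ → Seq n → Seq n → Seq n
  rightDisjunct : ℕ → Seq n → Fm n → Fm n
  agentDisjunct : ℕ → Seq n → Fin n → Fm n

  interpolant d Γ Δ = reduce d (weight Γ + weight Δ) [] Γ [] Δ

  reduce d w       Θ []      Ω []      = ⋁ (critical d Θ Ω)
  reduce d zero    Θ (_ ∷ _) Ω _       = bot
  reduce d zero    Θ []      Ω (_ ∷ _) = bot
  reduce d (suc w) Θ (F ∷ Γ) Ω Δ with atomic-or-compound F
  ... | inj₁ (sr-box i B) = reduce d w (□ i B ∷ Θ) (B ∷ Γ) Ω Δ
  ... | inj₁ (sr-var q)   = reduce d w (var q ∷ Θ) Γ Ω Δ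
  ... | inj₁ sr-bot       = reduce d w (bot ∷ Θ) Γ Ω Δ
  ... | inj₂ _            = ⋀ (map (λ (Ls , Rs) → reduce d w Θ (Ls ++ Γ) Ω (Rs ++ Δ)) (leftPremises F))
  reduce d (suc w) Θ [] Ω (F ∷ Δ) with atomic-or-compound F
  ... | inj₁ _ = reduce d w Θ [] (F ∷ Ω) Δ
  ... | inj₂ _ = ⋀ (map (λ (Ls , Rs) → reduce d w Θ Ls Ω (Rs ++ Δ)) (rightPremises F))

  -- Up to rules acting on Π ⇒ Λ, a derivation of Π, Θ ⇒ Ω, Λ ends in an axiom or in (□Kn), whose
  -- principal box lies either in Ω (rightDisjunct) or in Λ (agentDisjunct).
  critical d Θ Ω = map (leftLiteral Ω) Θ ++ map (rightDisjunct d Θ) Ω ++ map (agentDisjunct d Θ) (allFin n)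

  rightDisjunct d Θ (var q) with q ≟ℕ p
  ... | yes _ = bot
  ... | no  _ = var q
  rightDisjunct zero    Θ (□ i B) = bot
  rightDisjunct (suc d) Θ (□ i B) = □ i (interpolant d (boxes i Θ) (B ∷ []))
  rightDisjunct d       Θ _       = bot

  agentDisjunct zero    Θ i = bot
  agentDisjunct (suc d) Θ i = ¬' □ i (¬' interpolant d (boxes i Θ) [])

  data CriticalDisjunct (d : ℕ) (Θ Ω : Seq n) : Fm n → Set where
    left  : F ∈ Θ → CriticalDisjunct d Θ Ω (leftLiteral Ω F)
    right : F ∈ Ω → CriticalDisjunct d Θ Ω (rightDisjunct d Θ F)
    agent : ∀ i → CriticalDisjunct d Θ Ω (agentDisjunct d Θ i)

  critical-view : E ∈ critical d Θ Ω → CriticalDisjunct d Θ Ω E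
  critical-view {d = d} {Θ = Θ} {Ω = Ω} E∈ with ∈-++⁻ (map (leftLiteral Ω) Θ) E∈
  ... | inj₁ E∈ˡ with F , F∈Θ , refl ← ∈-map⁻ (leftLiteral Ω) E∈ˡ = left F∈Θ
  ... | inj₂ E∈′ with ∈-++⁻ (map (rightDisjunct d Θ) Ω) E∈′
  ...   | inj₁ E∈ʳ with F , F∈Ω , refl ← ∈-map⁻ (rightDisjunct d Θ) E∈ʳ = right F∈Ω
  ...   | inj₂ E∈ᵃ with i , _ , refl ← ∈-map⁻ (agentDisjunct d Θ) E∈ᵃ = agent i

  critical-∈ : ∀ d Θ → CriticalDisjunct d Θ Ω E → E ∈ critical d Θ Ω
  critical-∈ {Ω = Ω} d Θ (left F∈Θ) = ∈-++⁺ˡ (∈-map⁺ (leftLiteral Ω) F∈Θ)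
  critical-∈ {Ω = Ω} d Θ (right F∈Ω) =
    ∈-++⁺ʳ (map (leftLiteral Ω) Θ) (∈-++⁺ˡ (∈-map⁺ (rightDisjunct d Θ) F∈Ω))
  critical-∈ {Ω = Ω} d Θ (agent i) =
    ∈-++⁺ʳ (map (leftLiteral Ω) Θ)
      (∈-++⁺ʳ (map (rightDisjunct d Θ) Ω) (∈-map⁺ (agentDisjunct d Θ) (∈-allFin i)))

  -- Soundness

  leftLiteral-sound : F ∈ Θ → leftLiteral Ω F ∷ Θ ⊢ Ω
  leftLiteral-sound {F = var q} {Ω = Ω} F∈Θ with var-∈? q Ω | q ≟ℕ p
  ... | yes q∈Ω | _     = L¬ (ax⊢ F∈Θ (there q∈Ω))
  ... | no  _   | yes _ = botL
  ... | no  _   | no  _ = L¬ (ax⊢ F∈Θ (here refl))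
  leftLiteral-sound {F = bot}   F∈Θ = L¬ (ax⊥⊢ F∈Θ)
  leftLiteral-sound {F = _ ∧ _} _   = botL
  leftLiteral-sound {F = _ ∨ _} _   = botL
  leftLiteral-sound {F = _ ⇒ _} _   = botL
  leftLiteral-sound {F = ¬' _}  _   = botL
  leftLiteral-sound {F = □ _ _} _   = botL

  interpolant-sound   : ∀ d Γ Δ → interpolant d Γ Δ ∷ Γ ⊢ Δ
  sound               : ∀ d w Θ Γ Ω Δ → All SideR Θ → All SideR Ω →
                        reduce d w Θ Γ Ω Δ ∷ Θ ++ Γ ⊢ Ω ++ Δ
  critical-sound      : ∀ d Θ Ω → All SideR Θ → All SideR Ω → ⋁ (critical d Θ Ω) ∷ Θ ⊢ Ω
  rightDisjunct-sound : ∀ d Θ → All SideR Θ → All SideR Ω → F ∈ Ω → rightDisjunct d Θ F ∷ Θ ⊢ Ω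
  agentDisjunct-sound : ∀ d Θ i → All SideR Θ → All SideR Ω → agentDisjunct d Θ i ∷ Θ ⊢ Ω

  interpolant-sound d Γ Δ = sound d _ [] Γ [] Δ [] []

  sound d w Θ [] Ω [] θ ω =
    perm (prep _ (↭-reflexive (sym (++-identityʳ Θ)))) (↭-reflexive (sym (++-identityʳ Ω)))
      (critical-sound d Θ Ω θ ω)
  sound d zero Θ (_ ∷ _) Ω Δ       θ ω = botL
  sound d zero Θ []      Ω (_ ∷ _) θ ω = botL
  sound d (suc w) Θ (F ∷ Γ) Ω Δ θ ω with atomic-or-compound F
  ... | inj₁ (sr-box i B) =
    perm (solve 4 (λ b a t g → b ⊕ a ⊕ t ⊕ g ⊜ a ⊕ t ⊕ b ⊕ g) ↭-refl [ □ i B ] [ _ ] Θ Γ) ↭-refl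
      (□Tn i (perm (solve 5 (λ a b t c g → a ⊕ b ⊕ t ⊕ c ⊕ g ⊜ b ⊕ c ⊕ a ⊕ t ⊕ g)
                           ↭-refl [ _ ] [ □ i B ] Θ [ B ] Γ) ↭-refl
        (sound d w (□ i B ∷ Θ) (B ∷ Γ) Ω Δ (sr-box i B ∷ θ) ω)))
  ... | inj₁ (sr-var q) =
    perm (prep _ (↭-sym (shift _ Θ Γ))) ↭-refl (sound d w (var q ∷ Θ) Γ Ω Δ (sr-var q ∷ θ) ω)
  ... | inj₁ sr-bot =
    perm (prep _ (↭-sym (shift _ Θ Γ))) ↭-refl (sound d w (bot ∷ Θ) Γ Ω Δ (sr-bot ∷ θ) ω)
  ... | inj₂ c =
    perm (↭-trans (swap _ _ ↭-refl) (prep _ (↭-sym (shift _ Θ Γ)))) ↭-refl (leftRule c λ {Ls} {Rs} r →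
      perm (shifts (_ ∷ Θ) Ls) (shifts Ω Rs)
        (⋀-left (∈-map⁺ _ r) (sound d w Θ (Ls ++ Γ) Ω (Rs ++ Δ) θ ω)))
  sound d (suc w) Θ [] Ω (F ∷ Δ) θ ω with atomic-or-compound F
  ... | inj₁ a = perm ↭-refl (↭-sym (shift _ Ω Δ)) (sound d w Θ [] (F ∷ Ω) Δ θ (a ∷ ω))
  ... | inj₂ c =
    perm ↭-refl (↭-sym (shift _ Ω Δ)) (rightRule c λ {Ls} {Rs} r →
      perm (solve 3 (λ a t l → a ⊕ t ⊕ l ⊜ l ⊕ a ⊕ t ⊕ id) ↭-refl [ _ ] Θ Ls) (shifts Ω Rs)
        (⋀-left (∈-map⁺ _ r) (sound d w Θ Ls Ω (Rs ++ Δ) θ ω)))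

  critical-sound d Θ Ω θ ω = ⋁-left λ E∈ → disjunct-sound (critical-view E∈)
    where
    disjunct-sound : CriticalDisjunct d Θ Ω E → E ∷ Θ ⊢ Ω
    disjunct-sound (left F∈Θ)  = leftLiteral-sound F∈Θ
    disjunct-sound (right F∈Ω) = rightDisjunct-sound d Θ θ ω F∈Ω
    disjunct-sound (agent i)   = agentDisjunct-sound d Θ i θ ω

  rightDisjunct-sound {F = var q} d Θ θ ω F∈Ω with q ≟ℕ p
  ... | yes _ = botL
  ... | no  _ = ax⊢ (here refl) F∈Ω
  rightDisjunct-sound {F = □ i B} zero    Θ θ ω F∈Ω = botL
  rightDisjunct-sound {F = □ i B} (suc d) Θ θ ω F∈Ω with _ , π ← ∈⇒↭∷ F∈Ω =
    perm ↭-refl (↭-sym π)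
      (K⊢ i (box ∷ All.map (SideR⇒KnLeft i) θ) (All.tail (All-resp-↭ π ω))
        (subst (_⊢ B ∷ []) (sym (boxes-□ i _ Θ)) (interpolant-sound d (boxes i Θ) (B ∷ []))))
  rightDisjunct-sound {F = bot}   d Θ θ ω F∈Ω = botL
  rightDisjunct-sound {F = _ ∧ _} d Θ θ ω F∈Ω = botL
  rightDisjunct-sound {F = _ ∨ _} d Θ θ ω F∈Ω = botL
  rightDisjunct-sound {F = _ ⇒ _} d Θ θ ω F∈Ω = botL
  rightDisjunct-sound {F = ¬' _}  d Θ θ ω F∈Ω = botL

  agentDisjunct-sound zero    Θ i θ ω = botL
  agentDisjunct-sound (suc d) Θ i θ ω =
    L¬ (K⊢ i (All.map (SideR⇒KnLeft i) θ) ω (R¬ (interpolant-sound d (boxes i Θ) [])))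

  -- Variable condition

  Vars⊆ : Fm n → Seq n → Set
  Vars⊆ A X = (q : ℕ) → Occ q A → OccL q X × ¬ (q ≡ p)

  Vars⊆-⊑ : X ⊑ Y → Vars⊆ A X → Vars⊆ A Y
  Vars⊆-⊑ X⊑Y vars q o with o′ , q≢p ← vars q o = ⊑-occ X⊑Y o′ , q≢p

  leftLiteral-vars : F ∈ Θ → Vars⊆ (leftLiteral Ω F) Θ
  leftLiteral-vars {F = var q} {Ω = Ω} F∈Θ r o with var-∈? q Ω | q ≟ℕ p | o
  ... | yes _ | _       | occ-¬ ()
  ... | no  _ | no  q≢p | occ-¬ occ-var = lose F∈Θ occ-var , q≢p
  leftLiteral-vars {F = bot}   F∈Θ r (occ-¬ ())

  interpolant-vars   : ∀ d Γ Δ → Vars⊆ (interpolant d Γ Δ) (Γ ++ Δ)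
  vars               : ∀ d w Θ Γ Ω Δ → Vars⊆ (reduce d w Θ Γ Ω Δ) (Θ ++ Γ ++ Ω ++ Δ)
  critical-vars      : ∀ d Θ Ω → Vars⊆ (⋁ (critical d Θ Ω)) (Θ ++ Ω)
  rightDisjunct-vars : ∀ d Θ → F ∈ Ω → Vars⊆ (rightDisjunct d Θ F) (Θ ++ Ω)
  agentDisjunct-vars : ∀ d Θ i → Vars⊆ (agentDisjunct d Θ i) Θ

  interpolant-vars d Γ Δ = vars d _ [] Γ [] Δ

  vars d w Θ [] Ω [] =
    Vars⊆-⊑ (↭⇒⊑ (↭-reflexive (cong (Θ ++_) (sym (++-identityʳ Ω))))) (critical-vars d Θ Ω)
  vars d (suc w) Θ (F ∷ Γ) Ω Δ with atomic-or-compound F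
  ... | inj₁ (sr-box i B) = Vars⊆-⊑ (T-⊑ Θ (Γ ++ Ω ++ Δ)) (vars d w (□ i B ∷ Θ) (B ∷ Γ) Ω Δ)
  ... | inj₁ (sr-var q) = Vars⊆-⊑ (↭⇒⊑ (↭-sym (shift _ Θ (Γ ++ Ω ++ Δ)))) (vars d w (var q ∷ Θ) Γ Ω Δ)
  ... | inj₁ sr-bot     = Vars⊆-⊑ (↭⇒⊑ (↭-sym (shift _ Θ (Γ ++ Ω ++ Δ)))) (vars d w (bot ∷ Θ) Γ Ω Δ)
  ... | inj₂ c = λ q o → let (Ls , Rs) , r , o′ = ⋀-map-occ _ (leftPremises F) o in
    Vars⊆-⊑ (leftStep-⊑ Θ Γ Ω Δ r) (vars d w Θ (Ls ++ Γ) Ω (Rs ++ Δ)) q o′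
  vars d (suc w) Θ [] Ω (F ∷ Δ) with atomic-or-compound F
  ... | inj₁ _ = Vars⊆-⊑ (↭⇒⊑ (++⁺ˡ Θ (↭-sym (shift _ Ω Δ)))) (vars d w Θ [] (F ∷ Ω) Δ)
  ... | inj₂ c = λ q o → let (Ls , Rs) , r , o′ = ⋀-map-occ _ (rightPremises F) o in
    Vars⊆-⊑ (rightStep-⊑ Θ Ω Δ r) (vars d w Θ Ls Ω (Rs ++ Δ)) q o′

  critical-vars d Θ Ω q o with E , E∈ , oE ← find (⋁-occ o) = disjunct-vars (critical-view E∈) q oE
    where
    disjunct-vars : CriticalDisjunct d Θ Ω E → Vars⊆ E (Θ ++ Ω)
    disjunct-vars (left F∈Θ)  = Vars⊆-⊑ (⊆⇒⊑ ∈-++⁺ˡ) (leftLiteral-vars F∈Θ)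
    disjunct-vars (right F∈Ω) = rightDisjunct-vars d Θ F∈Ω
    disjunct-vars (agent i)   = Vars⊆-⊑ (⊆⇒⊑ ∈-++⁺ˡ) (agentDisjunct-vars d Θ i)

  rightDisjunct-vars {F = var q} d Θ F∈Ω r o with q ≟ℕ p | o
  ... | no q≢p | occ-var = lose (∈-++⁺ʳ Θ F∈Ω) occ-var , q≢p
  rightDisjunct-vars {F = □ i B} (suc d) Θ F∈Ω r (occ-□ o) =
    Vars⊆-⊑ (⊑-++ (⊑-trans (boxes-⊑ i Θ) (⊆⇒⊑ (xs⊆xs++ys Θ _)))
                  (≺⇒⊑ (□-body ∷ []) (∈-++⁺ʳ Θ F∈Ω)))
      (interpolant-vars d (boxes i Θ) (B ∷ [])) r o

  agentDisjunct-vars (suc d) Θ i r (occ-¬ (occ-□ (occ-¬ o))) =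
    Vars⊆-⊑ (⊑-trans (↭⇒⊑ (↭-reflexive (++-identityʳ (boxes i Θ)))) (boxes-⊑ i Θ))
      (interpolant-vars d (boxes i Θ) []) r o

  -- Completeness

  record Invariant (d : ℕ) (Θ Γ Ω Δ : Seq n) : Set where
    field
      Θ-atomic : All SideR Θ
      Ω-atomic : All SideR Ω
      bounded  : All (λ F → depth F ≤ d) (Θ ++ Γ ++ Ω ++ Δ)
      -- the body of a box moved to Θ has been decomposed into the sequent, which makes (□Tn) on
      -- that box redundant (complete-T)
      absorbed : ∀ {i B} → □ i B ∈ Θ → Absorbed (Θ ++ Γ) (Ω ++ Δ) (B ∷ []) []
  open Invariant

  Invariant-moveˡ : SideR F → (∀ {i B} → ¬ □ i B ≡ F) →
                    Invariant d Θ (F ∷ Γ) Ω Δ → Invariant d (F ∷ Θ) Γ Ω Δ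
  Invariant-moveˡ {Θ = Θ} {Γ = Γ} {Ω = Ω} {Δ = Δ} a not-box inv = record
    { Θ-atomic = a ∷ Θ-atomic inv
    ; Ω-atomic = Ω-atomic inv
    ; bounded  = ⊑-depth (↭⇒⊑ (↭-sym (shift _ Θ (Γ ++ Ω ++ Δ)))) (bounded inv)
    ; absorbed = λ { (here □≡F) → ⊥-elim (not-box □≡F)
                   ; (there □∈Θ) →
                       Absorbed-⊆ (∈-resp-↭ (shift _ Θ Γ)) (λ C∈ → C∈) (absorbed inv □∈Θ) }
    }

  Invariant-T : Invariant d Θ (□ i B ∷ Γ) Ω Δ → Invariant d (□ i B ∷ Θ) (B ∷ Γ) Ω Δ
  Invariant-T {Θ = Θ} {i = i} {B = B} {Γ = Γ} {Ω = Ω} {Δ = Δ} inv = record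
    { Θ-atomic = sr-box i B ∷ Θ-atomic inv
    ; Ω-atomic = Ω-atomic inv
    ; bounded  = ⊑-depth (T-⊑ Θ (Γ ++ Ω ++ Δ)) (bounded inv)
    ; absorbed = λ { (here refl) → memberˡ (∈-++⁺ʳ (□ i B ∷ Θ) (here refl)) []
                   ; (there □∈Θ) → Absorbed-⊆ T-⊆ (λ C∈ → C∈) (absorbed inv □∈Θ) }
    }
    where
    T-⊆ : Θ ++ □ i B ∷ Γ ⊆ □ i B ∷ Θ ++ B ∷ Γ
    T-⊆ C∈ with ∈-++⁻ Θ C∈
    ... | inj₁ C∈Θ         = there (∈-++⁺ˡ C∈Θ)
    ... | inj₂ (here refl) = here refl
    ... | inj₂ (there C∈Γ) = there (∈-++⁺ʳ Θ (there C∈Γ))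

  Invariant-left : Compound F → (Ls , Rs) ∈ leftPremises F →
                   Invariant d Θ (F ∷ Γ) Ω Δ → Invariant d Θ (Ls ++ Γ) Ω (Rs ++ Δ)
  Invariant-left {F = F} {Ls = Ls} {Rs = Rs} {Θ = Θ} {Γ = Γ} {Ω = Ω} {Δ = Δ} c r inv = record
    { Θ-atomic = Θ-atomic inv
    ; Ω-atomic = Ω-atomic inv
    ; bounded  = ⊑-depth (leftStep-⊑ Θ Γ Ω Δ r) (bounded inv)
    ; absorbed = Absorbed-trans replaced kept ∘ absorbed inv
    }
    where
    replaced : ∀ {C} → C ∈ Θ ++ F ∷ Γ → Absorbed (Θ ++ Ls ++ Γ) (Ω ++ Rs ++ Δ) (C ∷ []) []
    replaced C∈ with ∈-++⁻ Θ C∈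
    ... | inj₁ C∈Θ         = memberˡ (∈-++⁺ˡ C∈Θ) []
    ... | inj₂ (there C∈Γ) = memberˡ (∈-++⁺ʳ Θ (∈-++⁺ʳ Ls C∈Γ)) []
    ... | inj₂ (here refl) =
      ruleˡ c r (Absorbed-members (λ C∈ → ∈-++⁺ʳ Θ (∈-++⁺ˡ (∈-++-[] C∈)))
                                  (λ C∈ → ∈-++⁺ʳ Ω (∈-++⁺ˡ (∈-++-[] C∈))))
    kept : ∀ {C} → C ∈ Ω ++ Δ → Absorbed (Θ ++ Ls ++ Γ) (Ω ++ Rs ++ Δ) [] (C ∷ [])
    kept C∈ with ∈-++⁻ Ω C∈
    ... | inj₁ C∈Ω = memberʳ (∈-++⁺ˡ C∈Ω) []
    ... | inj₂ C∈Δ = memberʳ (∈-++⁺ʳ Ω (∈-++⁺ʳ Rs C∈Δ)) []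

  Invariant-moveʳ : SideR F → Invariant d Θ [] Ω (F ∷ Δ) → Invariant d Θ [] (F ∷ Ω) Δ
  Invariant-moveʳ {Θ = Θ} {Ω = Ω} {Δ = Δ} a inv = record
    { Θ-atomic = Θ-atomic inv
    ; Ω-atomic = a ∷ Ω-atomic inv
    ; bounded  = ⊑-depth (↭⇒⊑ (++⁺ˡ Θ (↭-sym (shift _ Ω Δ)))) (bounded inv)
    ; absorbed = Absorbed-⊆ (λ C∈ → C∈) (∈-resp-↭ (shift _ Ω Δ)) ∘ absorbed inv
    }

  Invariant-right : Compound F → (Ls , Rs) ∈ rightPremises F →
                    Invariant d Θ [] Ω (F ∷ Δ) → Invariant d Θ Ls Ω (Rs ++ Δ)
  Invariant-right {F = F} {Ls = Ls} {Rs = Rs} {Θ = Θ} {Ω = Ω} {Δ = Δ} c r inv = record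
    { Θ-atomic = Θ-atomic inv
    ; Ω-atomic = Ω-atomic inv
    ; bounded  = ⊑-depth (rightStep-⊑ Θ Ω Δ r) (bounded inv)
    ; absorbed = Absorbed-trans kept replaced ∘ absorbed inv
    }
    where
    kept : ∀ {C} → C ∈ Θ ++ [] → Absorbed (Θ ++ Ls) (Ω ++ Rs ++ Δ) (C ∷ []) []
    kept C∈ = memberˡ (∈-++⁺ˡ (∈-++-[] C∈)) []
    replaced : ∀ {C} → C ∈ Ω ++ F ∷ Δ → Absorbed (Θ ++ Ls) (Ω ++ Rs ++ Δ) [] (C ∷ [])
    replaced C∈ with ∈-++⁻ Ω C∈
    ... | inj₁ C∈Ω         = memberʳ (∈-++⁺ˡ C∈Ω) []
    ... | inj₂ (there C∈Δ) = memberʳ (∈-++⁺ʳ Ω (∈-++⁺ʳ Rs C∈Δ)) []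
    ... | inj₂ (here refl) =
      ruleʳ c r (Absorbed-members (λ C∈ → ∈-++⁺ʳ Θ (∈-++-[] C∈))
                                  (λ C∈ → ∈-++⁺ʳ Ω (∈-++⁺ˡ (∈-++-[] C∈))))

  Invariant-boxes : ∀ i → All (λ F → depth F ≤ d) Δ → Invariant (suc d) Θ [] Ω [] →
                    Invariant d [] (boxes i Θ) [] Δ
  Invariant-boxes {Θ = Θ} i Δ-bounded inv = record
    { Θ-atomic = []
    ; Ω-atomic = []
    ; bounded  = All.++⁺ (boxes-depth i (All.++⁻ˡ Θ (bounded inv))) Δ-bounded
    ; absorbed = λ ()
    }

  fuel-moveˡ : ∀ (F : Fm n) (Γ Δ : Seq n) → weight (F ∷ Γ) + weight Δ ≤ suc w → weight Γ + weight Δ ≤ w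
  fuel-moveˡ {w = w} F Γ Δ fuel =
    ≤-pred (<-≤-trans (m<n+m (weight Γ + weight Δ) (0<size F))
                      (subst (_≤ suc w) (+-assoc (size F) (weight Γ) (weight Δ)) fuel))

  fuel-moveʳ : ∀ (F : Fm n) (Δ : Seq n) → weight (F ∷ Δ) ≤ suc w → weight Δ ≤ w
  fuel-moveʳ F Δ fuel = ≤-pred (<-≤-trans (m<n+m (weight Δ) (0<size F)) fuel)

  fuel-left : (Ls , Rs) ∈ leftPremises F → weight (F ∷ Γ) + weight Δ ≤ suc w →
              weight (Ls ++ Γ) + weight (Rs ++ Δ) ≤ w
  fuel-left {Ls = Ls} {Rs = Rs} {F = F} {Γ = Γ} {Δ = Δ} {w = w} r fuel = ≤-pred (begin-strict
    weight (Ls ++ Γ) + weight (Rs ++ Δ)              ≡⟨ cong₂ _+_ (weight-++ Ls Γ) (weight-++ Rs Δ) ⟩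
    (weight Ls + weight Γ) + (weight Rs + weight Δ)  ≡⟨ interchange (weight Ls) (weight Γ) (weight Rs) (weight Δ) ⟩
    (weight Ls + weight Rs) + (weight Γ + weight Δ)  <⟨ +-monoˡ-< _ premise-lighter ⟩
    size F + (weight Γ + weight Δ)                   ≡⟨ sym (+-assoc (size F) (weight Γ) (weight Δ)) ⟩
    size F + weight Γ + weight Δ                     ≤⟨ fuel ⟩
    suc w                                            ∎)
    where
    open ≤-Reasoning
    premise-lighter : weight Ls + weight Rs < size F
    premise-lighter = subst (_< size F) (weight-++ Ls Rs) (leftPremise-weight r)

  fuel-right : (Ls , Rs) ∈ rightPremises F → weight (F ∷ Δ) ≤ suc w →
               weight Ls + weight (Rs ++ Δ) ≤ w
  fuel-right {Ls = Ls} {Rs = Rs} {F = F} {Δ = Δ} {w = w} r fuel = ≤-pred (begin-strict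
    weight Ls + weight (Rs ++ Δ)        ≡⟨ cong (weight Ls +_) (weight-++ Rs Δ) ⟩
    weight Ls + (weight Rs + weight Δ)  ≡⟨ sym (+-assoc (weight Ls) (weight Rs) (weight Δ)) ⟩
    (weight Ls + weight Rs) + weight Δ  <⟨ +-monoˡ-< _ premise-lighter ⟩
    size F + weight Δ                   ≤⟨ fuel ⟩
    suc w                               ∎)
    where
    open ≤-Reasoning
    premise-lighter : weight Ls + weight Rs < size F
    premise-lighter = subst (_< size F) (weight-++ Ls Rs) (rightPremise-weight r)

  rightDisjunct-complete : ¬ q ≡ p → var q ∈ Π → Π ⊢ rightDisjunct d Θ (var q) ∷ Λ
  rightDisjunct-complete {q = q} q≢p x with q ≟ℕ p
  ... | yes q≡p = ⊥-elim (q≢p q≡p)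
  ... | no  _   = ax⊢ x (here refl)

  leftLiteral-complete-Ω : var q ∈ Ω → Π ⊢ leftLiteral Ω (var q) ∷ Λ
  leftLiteral-complete-Ω {q = q} {Ω = Ω} q∈Ω with var-∈? q Ω
  ... | yes _   = ⊤′-right
  ... | no  q∉Ω = ⊥-elim (q∉Ω q∈Ω)

  leftLiteral-complete-Λ : ¬ q ≡ p → var q ∈ Λ → Π ⊢ leftLiteral Ω (var q) ∷ Λ
  leftLiteral-complete-Λ {q = q} {Ω = Ω} q≢p q∈Λ with var-∈? q Ω | q ≟ℕ p
  ... | yes _ | _       = ⊤′-right
  ... | no  _ | yes q≡p = ⊥-elim (q≢p q≡p)
  ... | no  _ | no  _   = R¬ (ax⊢ (here refl) q∈Λ)

  complete-ax : ∀ d Θ Ω → ¬ OccL p (Π ++ Λ) → var q ∈ Π ++ Θ → var q ∈ Ω ++ Λ →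
                Π ⊢ ⋁ (critical d Θ Ω) ∷ Λ
  complete-ax {Π = Π} d Θ Ω np x y with ∈-++⁻ Π x | ∈-++⁻ Ω y
  ... | inj₁ x∈Π | inj₂ y∈Λ = ax⊢ x∈Π (there y∈Λ)
  ... | inj₁ x∈Π | inj₁ y∈Ω =
    ⋁-right (critical-∈ d Θ (right y∈Ω)) (rightDisjunct-complete {d = d} {Θ = Θ} (var-fresh np (∈-++⁺ˡ x∈Π)) x∈Π)
  ... | inj₂ x∈Θ | inj₁ y∈Ω = ⋁-right (critical-∈ d Θ (left x∈Θ)) (leftLiteral-complete-Ω y∈Ω)
  ... | inj₂ x∈Θ | inj₂ y∈Λ =
    ⋁-right (critical-∈ d Θ (left x∈Θ)) (leftLiteral-complete-Λ (var-fresh np (∈-++⁺ʳ Π y∈Λ)) y∈Λ)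

  complete-ax⊥ : ∀ d Θ Ω → bot ∈ Π ++ Θ → Π ⊢ ⋁ (critical d Θ Ω) ∷ Λ
  complete-ax⊥ {Π = Π} d Θ Ω x with ∈-++⁻ Π x
  ... | inj₁ x∈Π = ax⊥⊢ x∈Π
  ... | inj₂ x∈Θ = ⋁-right (critical-∈ d Θ (left x∈Θ)) ⊤′-right

  complete          : ∀ {d w Θ Γ Ω Δ h} Π Λ → Invariant d Θ Γ Ω Δ → weight Γ + weight Δ ≤ w →
                      ¬ OccL p (Π ++ Λ) → Π ++ Θ ++ Γ ⊢[ h ] Ω ++ Δ ++ Λ → Π ⊢ reduce d w Θ Γ Ω Δ ∷ Λ
  complete-critical : ∀ {d Θ Ω h} Π Λ → Invariant d Θ [] Ω [] → ¬ OccL p (Π ++ Λ) →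
                      Π ++ Θ ⊢[ h ] Ω ++ Λ → Π ⊢ ⋁ (critical d Θ Ω) ∷ Λ
  complete-left     : ∀ {d Θ Ω h X₀} Π Λ → Invariant d Θ [] Ω [] → ¬ OccL p (Π ++ Λ) →
                      Compound F → Π ++ Θ ↭ F ∷ X₀ →
                      (∀ {Ls Rs} → (Ls , Rs) ∈ leftPremises F → Ls ++ X₀ ⊢[ h ] Rs ++ Ω ++ Λ) →
                      Π ⊢ ⋁ (critical d Θ Ω) ∷ Λ
  complete-right    : ∀ {d Θ Ω h Y₀} Π Λ → Invariant d Θ [] Ω [] → ¬ OccL p (Π ++ Λ) →
                      Compound F → Ω ++ Λ ↭ F ∷ Y₀ →
                      (∀ {Ls Rs} → (Ls , Rs) ∈ rightPremises F → Ls ++ Π ++ Θ ⊢[ h ] Rs ++ Y₀) →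
                      Π ⊢ ⋁ (critical d Θ Ω) ∷ Λ
  complete-T        : ∀ {d Θ Ω h i A X₀} Π Λ → Invariant d Θ [] Ω [] → ¬ OccL p (Π ++ Λ) →
                      Π ++ Θ ↭ □ i A ∷ X₀ → □ i A ∷ A ∷ X₀ ⊢[ h ] Ω ++ Λ →
                      Π ⊢ ⋁ (critical d Θ Ω) ∷ Λ
  complete-K-right  : ∀ {d Θ Ω h i A} Π Λ → Invariant d Θ [] Ω [] → ¬ OccL p (Π ++ Λ) →
                      □ i A ∈ Ω → All (KnLeft i) Π → All SideR Λ →
                      boxes i Π ++ boxes i Θ ⊢[ h ] A ∷ [] → Π ⊢ ⋁ (critical d Θ Ω) ∷ Λ
  complete-K-agent  : ∀ {d Θ Ω h i A Λ₀} Π Λ → Invariant d Θ [] Ω [] → ¬ OccL p (Π ++ Λ) →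
                      Λ ↭ □ i A ∷ Λ₀ → All (KnLeft i) Π → All SideR Λ₀ →
                      boxes i Π ++ boxes i Θ ⊢[ h ] A ∷ [] → Π ⊢ ⋁ (critical d Θ Ω) ∷ Λ

  complete {Θ = Θ} {[]} {Ω} {[]} Π Λ inv fuel np e =
    complete-critical Π Λ inv np (⊢-resp-↭ (++⁺ˡ Π (↭-reflexive (++-identityʳ Θ))) ↭-refl e)
  complete {w = zero} {Γ = F ∷ Γ} Π Λ inv fuel np e
    with () ← ≤-trans (≤-trans (0<size F) (≤-trans (m≤m+n _ _) (m≤m+n _ _))) fuel
  complete {w = zero} {Γ = []} {Δ = F ∷ Δ} Π Λ inv fuel np e
    with () ← ≤-trans (≤-trans (0<size F) (m≤m+n _ _)) fuel
  complete {d} {suc w} {Θ} {F ∷ Γ} {Ω} {Δ} Π Λ inv fuel np e with atomic-or-compound F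
  ... | inj₁ (sr-box i B) =
    complete Π Λ (Invariant-T inv) (≤-pred fuel) np (proj₂ (⊢⇒⊢[]
      (perm (solve 5 (λ b π t c g → b ⊕ π ⊕ t ⊕ c ⊕ g ⊜ π ⊕ c ⊕ t ⊕ b ⊕ g) ↭-refl [ B ] Π Θ [ □ i B ] Γ)
            ↭-refl
        (weakenˡ B (⊢[]⇒⊢ e)))))
  ... | inj₁ (sr-var q) =
    complete Π Λ (Invariant-moveˡ (sr-var q) (λ ()) inv) (fuel-moveˡ (var q) Γ Δ fuel) np
      (⊢-resp-↭ (++⁺ˡ Π (shift _ Θ Γ)) ↭-refl e)
  ... | inj₁ sr-bot =
    complete Π Λ (Invariant-moveˡ sr-bot (λ ()) inv) (fuel-moveˡ bot Γ Δ fuel) np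
      (⊢-resp-↭ (++⁺ˡ Π (shift _ Θ Γ)) ↭-refl e)
  ... | inj₂ c = ⋀-right-map _ (leftPremises F) λ {(Ls , Rs)} r →
    complete Π Λ (Invariant-left c r inv) (fuel-left r fuel) np
      (⊢-resp-↭ (solve 4 (λ l π t g → l ⊕ π ⊕ t ⊕ g ⊜ π ⊕ t ⊕ l ⊕ g) ↭-refl Ls Π Θ Γ)
                (solve 4 (λ r o δ λ′ → r ⊕ o ⊕ δ ⊕ λ′ ⊜ o ⊕ (r ⊕ δ) ⊕ λ′) ↭-refl Rs Ω Δ Λ)
        (invertˡ c r (solve 4 (λ π t f g → π ⊕ t ⊕ f ⊕ g ⊜ f ⊕ π ⊕ t ⊕ g) ↭-refl Π Θ [ F ] Γ) e))
  complete {d} {suc w} {Θ} {[]} {Ω} {F ∷ Δ} Π Λ inv fuel np e with atomic-or-compound F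
  ... | inj₁ a =
    complete Π Λ (Invariant-moveʳ a inv) (fuel-moveʳ F Δ fuel) np (⊢-resp-↭ ↭-refl (shift _ Ω (Δ ++ Λ)) e)
  ... | inj₂ c = ⋀-right-map _ (rightPremises F) λ {(Ls , Rs)} r →
    complete Π Λ (Invariant-right c r inv) (fuel-right r fuel) np
      (⊢-resp-↭ (solve 3 (λ l π t → l ⊕ π ⊕ t ⊕ id ⊜ π ⊕ t ⊕ l) ↭-refl Ls Π Θ)
                (solve 4 (λ r o δ λ′ → r ⊕ o ⊕ δ ⊕ λ′ ⊜ o ⊕ (r ⊕ δ) ⊕ λ′) ↭-refl Rs Ω Δ Λ)
        (invertʳ c r (shift _ Ω (Δ ++ Λ)) e))

  complete-critical {d} {Θ} {Ω} Π Λ inv np (ax q x y) = complete-ax d Θ Ω np x y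
  complete-critical {d} {Θ} {Ω} Π Λ inv np (ax⊥ x)    = complete-ax⊥ d Θ Ω x
  complete-critical {h = suc h} Π Λ inv np (left c π prem)  = complete-left Π Λ inv np c π prem
  complete-critical {h = suc h} Π Λ inv np (right c π prem) = complete-right Π Λ inv np c π prem
  complete-critical {h = suc h} Π Λ inv np (T i π e)        = complete-T Π Λ inv np π e
  complete-critical {Θ = Θ} {Ω = Ω} Π Λ inv np (K {Y₀ = Y₀} i ok sides π e)
    with ∈-++⁻ Ω (∈-resp-↭ (↭-sym π) (here refl))
  ... | inj₁ □∈Ω with Ω₀ , πΩ ← ∈⇒↭∷ □∈Ω =
    complete-K-right Π Λ inv np □∈Ω (All.++⁻ˡ Π ok)
      (All.++⁻ʳ Ω₀ (All-resp-↭ (drop-∷ (↭-trans (↭-sym π) (++⁺ʳ Λ πΩ))) sides))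
      (subst (_⊢[ _ ] _) (boxes-++ i Π Θ) e)
  ... | inj₂ □∈Λ with Λ₀ , πΛ ← ∈⇒↭∷ □∈Λ =
    complete-K-agent Π Λ inv np πΛ (All.++⁻ˡ Π ok)
      (All.++⁻ʳ Ω (All-resp-↭ (drop-∷ (↭-trans (↭-sym π) (↭-trans (++⁺ˡ Ω πΛ) (shift _ Ω Λ₀)))) sides))
      (subst (_⊢[ _ ] _) (boxes-++ i Π Θ) e)

  complete-left {Θ = Θ} {Ω = Ω} {X₀ = X₀} Π Λ inv np c π prem with ∈-++⁻ Π (∈-resp-↭ (↭-sym π) (here refl))
  ... | inj₂ F∈Θ = ⊥-elim (compound-¬atomic c (All.lookup (Θ-atomic inv) F∈Θ))
  ... | inj₁ F∈Π with Π₀ , πΠ ← ∈⇒↭∷ F∈Π = perm (↭-sym πΠ) ↭-refl (leftRule c premise)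
    where
    premise : (Ls , Rs) ∈ leftPremises _ → Ls ++ Π₀ ⊢ Rs ++ ⋁ (critical _ Θ Ω) ∷ Λ
    premise {Ls} {Rs} r =
      perm ↭-refl (↭-sym (shift _ Rs Λ)) (complete-critical (Ls ++ Π₀) (Rs ++ Λ) inv p-free
        (⊢-resp-↭ (↭-trans (++⁺ˡ Ls X₀↭) (↭-reflexive (sym (++-assoc Ls Π₀ Θ)))) (shifts Rs Ω) (prem r)))
      where
      X₀↭ : X₀ ↭ Π₀ ++ Θ
      X₀↭ = drop-∷ (↭-trans (↭-sym π) (++⁺ʳ Θ πΠ))
      p-free : ¬ OccL p ((Ls ++ Π₀) ++ Rs ++ Λ)
      p-free = ¬OccL-⊑ (⊑-replace (leftPremise-≺ r)
        (solve 4 (λ l π r λ′ → (l ⊕ π) ⊕ r ⊕ λ′ ⊜ (l ⊕ r) ⊕ π ⊕ λ′) ↭-refl Ls Π₀ Rs Λ)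
        (++⁺ʳ Λ πΠ)) np

  complete-right {Θ = Θ} {Ω = Ω} {Y₀ = Y₀} Π Λ inv np c π prem with ∈-++⁻ Ω (∈-resp-↭ (↭-sym π) (here refl))
  ... | inj₁ F∈Ω = ⊥-elim (compound-¬atomic c (All.lookup (Ω-atomic inv) F∈Ω))
  ... | inj₂ F∈Λ with Λ₀ , πΛ ← ∈⇒↭∷ F∈Λ =
    perm ↭-refl (↭-trans (swap _ _ ↭-refl) (prep _ (↭-sym πΛ))) (rightRule c premise)
    where
    premise : (Ls , Rs) ∈ rightPremises _ → Ls ++ Π ⊢ Rs ++ ⋁ (critical _ Θ Ω) ∷ Λ₀
    premise {Ls} {Rs} r =
      perm ↭-refl (↭-sym (shift _ Rs Λ₀)) (complete-critical (Ls ++ Π) (Rs ++ Λ₀) inv p-free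
        (⊢-resp-↭ (↭-reflexive (sym (++-assoc Ls Π Θ))) (↭-trans (++⁺ˡ Rs Y₀↭) (shifts Rs Ω)) (prem r)))
      where
      Y₀↭ : Y₀ ↭ Ω ++ Λ₀
      Y₀↭ = drop-∷ (↭-trans (↭-sym π) (↭-trans (++⁺ˡ Ω πΛ) (shift _ Ω Λ₀)))
      p-free : ¬ OccL p ((Ls ++ Π) ++ Rs ++ Λ₀)
      p-free = ¬OccL-⊑ (⊑-replace (rightPremise-≺ r)
        (solve 4 (λ l π r λ′ → (l ⊕ π) ⊕ r ⊕ λ′ ⊜ (l ⊕ r) ⊕ π ⊕ λ′) ↭-refl Ls Π Rs Λ₀)
        (↭-trans (++⁺ˡ Π πΛ) (shift _ Π Λ₀))) np

  complete-T {Θ = Θ} {A = A} Π Λ inv np π e with ∈-++⁻ Π (∈-resp-↭ (↭-sym π) (here refl))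
  ... | inj₂ □∈Θ =
    complete-critical Π Λ inv np
      (absorb (absorbed inv □∈Θ) (λ C∈ → ∈-++⁺ʳ Π (∈-++-[] C∈)) (λ C∈ → ∈-++⁺ˡ (∈-++-[] C∈))
        (⊢-resp-↭ (↭-trans (swap _ _ ↭-refl) (prep A (↭-sym π))) ↭-refl e))
  ... | inj₁ □∈Π with Π₀ , πΠ ← ∈⇒↭∷ □∈Π =
    perm (↭-sym πΠ) ↭-refl (□Tn _ (complete-critical (_ ∷ A ∷ Π₀) Λ inv p-free
      (⊢-resp-↭ (prep _ (prep _ (drop-∷ (↭-trans (↭-sym π) (++⁺ʳ Θ πΠ))))) ↭-refl e)))
    where
    p-free : ¬ OccL p ((_ ∷ A ∷ Π₀) ++ Λ)
    p-free = ¬OccL-⊑ (⊑-trans (↭⇒⊑ (swap _ _ ↭-refl))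
      (⊑-++ (≺⇒⊑ (□-body ∷ []) (∈-++⁺ˡ □∈Π)) (↭⇒⊑ (↭-sym (++⁺ʳ Λ πΠ))))) np

  complete-K-right {zero} {Θ} {Ω} Π Λ inv np □∈Ω ok sides e
    with () ← All.lookup (bounded inv) (∈-++⁺ʳ Θ (∈-++⁺ˡ □∈Ω))
  complete-K-right {suc d} {Θ} {Ω} {i = i} {A = A} Π Λ inv np □∈Ω ok sides e =
    ⋁-right (critical-∈ (suc d) Θ (right □∈Ω))
      (K⊢ i ok sides (complete (boxes i Π) [] (Invariant-boxes i (A≤d ∷ []) inv) ≤-refl p-free e))
    where
    A≤d : depth A ≤ d
    A≤d = ≤-pred (All.lookup (bounded inv) (∈-++⁺ʳ Θ (∈-++⁺ˡ □∈Ω)))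
    p-free : ¬ OccL p (boxes i Π ++ [])
    p-free = ¬OccL-⊑ (⊑-++ (⊑-trans (boxes-⊑ i Π) (⊆⇒⊑ (xs⊆xs++ys Π Λ))) (λ ())) np

  complete-K-agent {zero} {Θ} {i = i} Π Λ inv np πΛ ok sides e =
    weakenʳ _ (perm ↭-refl (↭-sym πΛ) (K⊢ i ok sides (⊢[]⇒⊢ (subst (_⊢[ _ ] _) no-Θ-boxes e))))
    where
    no-Θ-boxes : boxes i Π ++ boxes i Θ ≡ boxes i Π
    no-Θ-boxes = trans (cong (boxes i Π ++_) (no-boxes i (All.++⁻ˡ Θ (bounded inv)))) (++-identityʳ _)
  complete-K-agent {suc d} {Θ} {i = i} {A = A} Π Λ inv np πΛ ok sides e =
    ⋁-right (critical-∈ (suc d) Θ (agent i)) (R¬ (perm ↭-refl (↭-sym πΛ) (K⊢ i (box ∷ ok) sides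
      (subst (_⊢ A ∷ []) (sym (boxes-□ i _ Π))
        (L¬ (complete (boxes i Π) (A ∷ []) (Invariant-boxes i [] inv) ≤-refl p-free e))))))
    where
    p-free : ¬ OccL p (boxes i Π ++ A ∷ [])
    p-free = ¬OccL-⊑ (⊑-++ (⊑-trans (boxes-⊑ i Π) (⊆⇒⊑ (xs⊆xs++ys Π Λ)))
                           (≺⇒⊑ (□-body ∷ []) (∈-++⁺ʳ Π (∈-resp-↭ (↭-sym πΛ) (here refl))))) np

  interpolant-complete : ∀ {d Γ Δ} → All (λ F → depth F ≤ d) (Γ ++ Δ) →
                         ∀ Π Λ → ¬ OccL p (Π ++ Λ) → Π ++ Γ ⊢ Δ ++ Λ → Π ⊢ interpolant d Γ Δ ∷ Λ
  interpolant-complete bounded Π Λ np der =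
    complete Π Λ (record { Θ-atomic = [] ; Ω-atomic = [] ; bounded = bounded ; absorbed = λ () }) ≤-refl np
      (proj₂ (⊢⇒⊢[] der))

corollary4p17 : (n : ℕ) (Γ Δ : List (Fm n)) (p : ℕ) →
    Σ (Fm n) (λ A →
      ((q : ℕ) → Occ q A → OccL q (Γ ++ Δ) × ¬ (q ≡ p))
      × (A ∷ Γ) ⊢ Δ
      × ((Π Λ : List (Fm n)) → ¬ OccL p (Π ++ Λ) → (Π ++ Γ) ⊢ (Δ ++ Λ) → Π ⊢ (A ∷ Λ)))
corollary4p17 n Γ Δ p =
  interpolant d Γ Δ , interpolant-vars d Γ Δ , interpolant-sound d Γ Δ , interpolant-complete bounded
  where
  open Interpolant p
  d : ℕ
  d = max 0 (map depth (Γ ++ Δ))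
  bounded : All (λ F → depth F ≤ d) (Γ ++ Δ)
  bounded = All.map⁻ (xs≤max 0 (map depth (Γ ++ Δ)))
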